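{- Let $L$ be a subspace of $\bigwedge^kV$ and $I\subseteq[n]$. Consider the procedure that, as long as there is a pair $i<j$ in $I$ with $N_{j\to i}L\ne L$, replaces $L$ by $N_{j\to i}L$, where at each step the pair chosen is the lexicographically last ordered pair $(j,i)$ (with $i<j$, $i,j\in I$, lexicographic order induced by the usual order on $[n]$) for which $N_{j\to i}L\neq L$. Then this procedure terminates after at most $|I|-1+\binom{|I|}{2}$ iterations.
   Context: Let $\mathbb{F}$ be a field (the paper assumes characteristic $\neq2$), $V$ an $n$-dimensional $\mathbb{F}$-space with fixed basis $e_1,\dots,e_n$. $\bigwedge^kV$ has basis the monomials $e_S=e_{s_1}\wedge\cdots\wedge e_{s_k}$ with variable set $\{e_s:s\in S\}$; the support of a form is the set of monomials with nonzero coefficient. Slow shifting: let $t$ be transcendental over $\mathbb{F}$, $V(t)=V\otimes\mathbb{F}(t)$, and for distinct $i,j$ let $N_{j\to i}(t)$ be the linear map $e_j\mapsto e_i+te_j$, $e_h\mapsto e_h$ ($h\ne j$), extended to $\bigwedge V(t)$ multiplicatively. For nonzero $m\in\bigwedge^kV$, $N_{j\to i}m$ is obtained (up to scalar) by rescaling $N_{j\to i}(t)m$ so its coefficients are polynomials in $t$ with no common factor of positive degree and evaluating at $t=0$. Explicitly, writing $m=x+e_j\wedge y$ with no monomial in the supports of $x,y$ having $e_j$ in its variable set, $N_{j\to i}m=x+e_i\wedge y$ if this is nonzero, and $e_j\wedge y$ otherwise. For a subspace $L$, $N_{j\to i}L$ is the limit subspace (via the analogous limit of the Plücker point of a basis of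 $L$); it equals the span of $\{N_{j\to i}m:0\ne m\in L\}$ and has dimension $\dim L$. -}

module Defs where

open import Level using (Level; _⊔_; suc)
open import Algebra.Bundles using (CommutativeRing)
open import Data.Nat as ℕ using (ℕ; zero; suc; _<ᵇ_)
open import Data.Bool using (Bool; true; false; if_then_else_; _∧_)
open import Data.Fin as Fin using (Fin; toℕ)
open import Data.Fin.Subset using (Subset; inside; outside; _∈_; ∣_∣)
open import Data.Vec using (lookup; tabulate; _[_]≔_)
open import Data.List using (List; []; _∷_)
open import Data.Product using (Σ; ∃; _×_; _,_)
open import Data.Sum using (_⊎_)
open import Relation.Nullary using (¬_)
open import Relation.Binary.PropositionalEquality using (_≡_)

record Field (c ℓ : Level) : Set (Level.suc (c ⊔ ℓ)) where
  field
    commutativeRing : CommutativeRing c ℓ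
  open CommutativeRing commutativeRing public
  field
    1≉0     : ¬ (1# ≈ 0#)
    inverse : ∀ x → ¬ (x ≈ 0#) → Σ Carrier λ y → (x * y) ≈ 1#

CharNot2 : ∀ {c ℓ} → Field c ℓ → Set ℓ
CharNot2 F = ¬ ((1# + 1#) ≈ 0#) where open Field F

-- Exterior algebra ⋀V of V = F^n with basis e_1..e_n: an element is given by
-- its coefficients on the monomials e_S (S ⊆ [n], variables in increasing order).
module Exterior {c ℓ} (F : Field c ℓ) (n : ℕ) where
  open Field F

  Form : Set c
  Form = Subset n → Carrier

  _≐_ : Form → Form → Set ℓ
  u ≐ v = ∀ S → u S ≈ v S

  zeroF : Form
  zeroF _ = 0#

  _+F_ : Form → Form → Form
  (u +F v) S = u S + v S

  _·F_ : Carrier → Form → Form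
  (a ·F u) S = a * u S

  Homogeneous : ℕ → Form → Set ℓ
  Homogeneous k m = ∀ S → ¬ (∣ S ∣ ≡ k) → m S ≈ 0#

  signPow : ℕ → Carrier
  signPow zero    = 1#
  signPow (suc r) = - signPow r

  countBelow : Fin n → Subset n → ℕ
  countBelow i S = ∣ tabulate (λ s → lookup S s ∧ (toℕ s <ᵇ toℕ i)) ∣

  -- e_i ∧ y
  wedge : Fin n → Form → Form
  wedge i y S = if lookup S i
                then signPow (countBelow i S) * y (S [ i ]≔ outside)
                else 0#

  -- m = x + e_j ∧ y with no monomial of x or y containing e_j
  partX : Fin n → Form → Form
  partX j m S = if lookup S j then 0# else m S

  partY : Fin n → Form → Form
  partY j m T = if lookup T j then 0#
                else signPow (countBelow j (T [ j ]≔ inside)) * m (T [ j ]≔ inside)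

  -- r is (a representative of) N_{j→i} m :
  -- x + e_i ∧ y if nonzero, otherwise e_j ∧ y
  NRel : Fin n → Fin n → Form → Form → Set ℓ
  NRel i j m r =
    let z = partX j m +F wedge i (partY j m) in
    (¬ (z ≐ zeroF) × (r ≐ z)) ⊎ ((z ≐ zeroF) × (r ≐ wedge j (partY j m)))

  Sub : Set (Level.suc (c ⊔ ℓ))
  Sub = Form → Set (c ⊔ ℓ)

  _≡ₛ_ : Sub → Sub → Set (c ⊔ ℓ)
  P ≡ₛ Q = ∀ v → (P v → Q v) × (Q v → P v)

  linComb : List (Carrier × Form) → Form
  linComb []             = zeroF
  linComb ((a , w) ∷ cs) = (a ·F w) +F linComb cs

  data AllSnd (P : Sub) : List (Carrier × Form) → Set (c ⊔ ℓ) where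
    []  : AllSnd P []
    _∷_ : ∀ {a w cs} → P w → AllSnd P cs → AllSnd P ((a , w) ∷ cs)

  Span : Sub → Sub
  Span P v = Σ (List (Carrier × Form)) λ cs → AllSnd P cs × (v ≐ linComb cs)

  linCombL : List Carrier → List Form → Form
  linCombL (a ∷ as) (g ∷ gs) = (a ·F g) +F linCombL as gs
  linCombL _        _        = zeroF

  SpanList : List Form → Sub
  SpanList gs v = Σ (List Carrier) λ as → v ≐ linCombL as gs

  NSub : Fin n → Fin n → Sub → Sub
  NSub i j L = Span (λ r → ∃ λ m → L m × ¬ (m ≐ zeroF) × NRel i j m r)

  LexLt : Fin n → Fin n → Fin n → Fin n → Set
  LexLt j i j' i' = (j Fin.< j') ⊎ ((j ≡ j') × (i Fin.< i'))

  Step : Subset n → Sub → Sub → Set (c ⊔ ℓ)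
  Step I L L' =
    Σ (Fin n) λ i → Σ (Fin n) λ j →
      (i Fin.< j) × (i ∈ I) × (j ∈ I) ×
      ¬ (NSub i j L ≡ₛ L) ×
      (L' ≡ₛ NSub i j L) ×
      (∀ i' j' → i' Fin.< j' → i' ∈ I → j' ∈ I → LexLt j i j' i' →
         NSub i' j' L ≡ₛ L)

-- Write m = x + e_j ∧ y with e_j absent from x and y.  A subspace L is fixed by N_{j→i}
-- exactly when it is closed under m ↦ x (partX j) and m ↦ e_i ∧ y (transfer j i); these
-- closure properties survive an application of N_{j→i} for every pair lexicographically
-- after (j , i), and N_{j→i} L is always closed under partX j.  Hence the pairs chosen by the
-- procedure never increase lexicographically.  A pair is chosen twice in a row only if no
-- element of I lies strictly between i and j (such an h makes (j , h) fixed, so L is already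
-- partX j–closed and one application of N_{j→i} reaches a fixed point), and never three times
-- in a row.  Counting the pairs of I, with the |I| - 1 adjacent ones counted twice, gives
-- (|I| - 1) + C(|I|, 2).  Whether a form vanishes is undecidable over an arbitrary field, so
-- the argument runs in the double-negation monad; the conclusion is a decidable inequality.
module Submission where

open import Defs
open import Level using (_⊔_)
open import Data.Nat as ℕ using (ℕ; zero; suc; _<ᵇ_)
open import Data.Nat.Properties as ℕ using (<ᵇ⇒<; <⇒<ᵇ)
open import Data.Nat.Combinatorics using (_C_; nC1≡n; nCk+nC[k+1]≡[n+1]C[k+1]; k>n⇒nCk≡0)
open import Data.Bool using (Bool; true; false; not; _xor_; _∧_)
open import Data.Bool.Properties
  using (xor-same; xor-identityʳ; xor-comm; true-xor; not-involutive; not-distribˡ-xor; ∧-zeroʳ; T-≡)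
open import Data.Fin as Fin using (Fin; toℕ)
import Data.Fin.Properties as Fin
open import Data.Fin.Subset using (Subset; inside; outside; ∣_∣; _∈_; _⊆_)
open import Data.Fin.Subset.Properties using (p⊆q⇒∣p∣≤∣q∣; p⊂q⇒∣p∣<∣q∣)
open import Data.Vec using ([]; _∷_; lookup; tabulate; _[_]≔_)
open import Data.Vec.Properties
  using (lookup∘update; lookup∘update′; lookup∘tabulate; tabulate-cong; tabulate∘lookup; []≔-commutes; []≔-idempotent;
         []≔-lookup; []≔-updates; []≔-minimal; []=⇒lookup; lookup⇒[]=)
open import Data.Product using (Σ; ∃; _×_; _,_; proj₁; proj₂)
open import Data.Product.Relation.Binary.Lex.Strict using (×-Lex; ×-compare)
open import Data.Sum using (_⊎_; inj₁; inj₂; [_,_])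
open import Data.Empty using (⊥; ⊥-elim)
open import Function using (_∘_; id; Equivalence)
open import Relation.Binary using (Setoid; tri<; tri≈; tri>)
import Relation.Binary.Reasoning.Setoid as SetoidReasoning
open import Relation.Binary.PropositionalEquality
  using (_≡_; _≢_; refl; sym; trans; cong; cong₂; subst; subst₂; module ≡-Reasoning)
open import Relation.Nullary using (¬_; yes; no)
open import Relation.Nullary.Negation using (DoubleNegation; negated-stable; ¬¬-map; contradiction)
open import Relation.Nullary.Decidable using (¬¬-excluded-middle)
open import Data.List using (List; []; _∷_; map; _++_)
open import Data.List.Relation.Unary.All as All using (All; []; _∷_)
import Data.List.Relation.Unary.All.Properties as All
open import Data.List.Relation.Unary.Any using (here)
open import Data.List.Membership.Propositional using () renaming (_∈_ to _∈ₗ_)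
open import Data.List.Membership.Propositional.Properties using (∈-map⁺; ∈-++⁺ˡ; ∈-++⁺ʳ)
import Algebra.Properties.Ring as RingProperties
import Algebra.Properties.CommutativeSemigroup as CommutativeSemigroupProperties

infixl 1 _>>=_
_>>=_ : ∀ {a b} {A : Set a} {B : Set b} → DoubleNegation A → (A → DoubleNegation B) → DoubleNegation B
¬¬a >>= f = negated-stable (¬¬-map f ¬¬a)

return : ∀ {a} {A : Set a} → A → DoubleNegation A
return = contradiction

¬¬-All : ∀ {a p} {A : Set a} {P : A → Set p} {xs : List A} → All (DoubleNegation ∘ P) xs → DoubleNegation (All P xs)
¬¬-All []         = return []
¬¬-All (px ∷ pxs) = px >>= λ x → ¬¬-All pxs >>= λ xs → return (x ∷ xs)

∧≡true⁻ : ∀ {x y} → x ∧ y ≡ true → x ≡ true × y ≡ true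
∧≡true⁻ {true} {true} refl = refl , refl

xor-true : ∀ b → b xor true ≡ not b
xor-true b = trans (xor-comm b true) (true-xor b)

xor-swap : ∀ p q x y → x xor y ≡ true → p xor (q xor x) ≡ not (q xor (p xor y))
xor-swap false false true  false _ = refl
xor-swap false true  true  false _ = refl
xor-swap true  false true  false _ = refl
xor-swap true  true  true  false _ = refl
xor-swap false false false true  _ = refl
xor-swap false true  false true  _ = refl
xor-swap true  false false true  _ = refl
xor-swap true  true  false true  _ = refl

xor-swap′ : ∀ {p q x y p₁ q₁ q₂ p₂} → x xor y ≡ true →
            p₁ ≡ p → q₁ ≡ q xor x → q₂ ≡ q → p₂ ≡ p xor y → p₁ xor q₁ ≡ not (q₂ xor p₂)
xor-swap′ {p} {q} {x} {y} x⊕y refl refl refl refl = xor-swap p q x y x⊕y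

odd : ℕ → Bool
odd zero    = false
odd (suc r) = not (odd r)

odd-∣[]≔∣ : ∀ {k} (p : Subset k) a x → odd ∣ p [ a ]≔ x ∣ ≡ odd ∣ p ∣ xor (x xor lookup p a)
odd-∣[]≔∣ (true  ∷ p) Fin.zero true  = sym (xor-identityʳ _)
odd-∣[]≔∣ (false ∷ p) Fin.zero false = sym (xor-identityʳ _)
odd-∣[]≔∣ (false ∷ p) Fin.zero true  = sym (xor-true (odd ∣ p ∣))
odd-∣[]≔∣ (true  ∷ p) Fin.zero false = trans (sym (not-involutive _)) (sym (xor-true (not (odd ∣ p ∣))))
odd-∣[]≔∣ (false ∷ p) (Fin.suc a) x = odd-∣[]≔∣ p a x
odd-∣[]≔∣ (true  ∷ p) (Fin.suc a) x =
  trans (cong not (odd-∣[]≔∣ p a x)) (not-distribˡ-xor (odd ∣ p ∣) (x xor lookup p a))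

module _ {n : ℕ} where

  infix 5 _≺ᵇ_
  _≺ᵇ_ : Fin n → Fin n → Bool
  a ≺ᵇ b = toℕ a <ᵇ toℕ b

  ≺ᵇ⇒< : ∀ {a b} → a ≺ᵇ b ≡ true → a Fin.< b
  ≺ᵇ⇒< {a} {b} a≺b = <ᵇ⇒< (toℕ a) (toℕ b) (Equivalence.from T-≡ a≺b)

  <⇒≺ᵇ : ∀ {a b} → a Fin.< b → a ≺ᵇ b ≡ true
  <⇒≺ᵇ a<b = Equivalence.to T-≡ (<⇒<ᵇ a<b)

  ≮⇒≺ᵇ : ∀ {a b} → ¬ a Fin.< b → a ≺ᵇ b ≡ false
  ≮⇒≺ᵇ {a} {b} a≮b with a ≺ᵇ b in eq
  ... | true  = ⊥-elim (a≮b (≺ᵇ⇒< eq))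
  ... | false = refl

  ≺ᵇ-irrefl : ∀ a → (a ≺ᵇ a) ≡ false
  ≺ᵇ-irrefl a = ≮⇒≺ᵇ {a} {a} (ℕ.<-irrefl refl)

  ≺ᵇ-xor : ∀ {a b} → a ≢ b → (a ≺ᵇ b) xor (b ≺ᵇ a) ≡ true
  ≺ᵇ-xor {a} {b} a≢b with Fin.<-cmp a b
  ... | tri< a<b _ b≮a rewrite <⇒≺ᵇ a<b | ≮⇒≺ᵇ b≮a = refl
  ... | tri≈ _ a≡b _   = ⊥-elim (a≢b a≡b)
  ... | tri> a≮b _ b<a rewrite ≮⇒≺ᵇ a≮b | <⇒≺ᵇ b<a = refl

  below : Subset n → Fin n → Subset n
  below S k = tabulate (λ s → lookup S s ∧ (s ≺ᵇ k))

  below-[]≔ : ∀ S k a x → below (S [ a ]≔ x) k ≡ below S k [ a ]≔ (x ∧ (a ≺ᵇ k))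
  below-[]≔ S k a x = trans (tabulate-cong pointwise) (tabulate∘lookup _)
    where
    pointwise : ∀ s → lookup (S [ a ]≔ x) s ∧ (s ≺ᵇ k) ≡ lookup (below S k [ a ]≔ (x ∧ (a ≺ᵇ k))) s
    pointwise s with s Fin.≟ a
    ... | yes refl = trans (cong (_∧ (s ≺ᵇ k)) (lookup∘update s S x)) (sym (lookup∘update s (below S k) _))
    ... | no s≢a   = trans (cong (_∧ (s ≺ᵇ k)) (lookup∘update′ s≢a S x))
                           (sym (trans (lookup∘update′ s≢a (below S k) _) (lookup∘tabulate _ s)))

  odd-∣below[]≔∣ : ∀ S k a x →
    odd ∣ below (S [ a ]≔ x) k ∣ ≡ odd ∣ below S k ∣ xor ((x ∧ (a ≺ᵇ k)) xor (lookup S a ∧ (a ≺ᵇ k)))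
  odd-∣below[]≔∣ S k a x = begin
    odd ∣ below (S [ a ]≔ x) k ∣
      ≡⟨ cong (λ p → odd ∣ p ∣) (below-[]≔ S k a x) ⟩
    odd ∣ below S k [ a ]≔ (x ∧ (a ≺ᵇ k)) ∣
      ≡⟨ odd-∣[]≔∣ (below S k) a _ ⟩
    odd ∣ below S k ∣ xor ((x ∧ (a ≺ᵇ k)) xor lookup (below S k) a)
      ≡⟨ cong (λ b → odd ∣ below S k ∣ xor ((x ∧ (a ≺ᵇ k)) xor b)) (lookup∘tabulate _ a) ⟩
    odd ∣ below S k ∣ xor ((x ∧ (a ≺ᵇ k)) xor (lookup S a ∧ (a ≺ᵇ k))) ∎
    where open ≡-Reasoning

  odd-∣below-self∣ : ∀ S k x → odd ∣ below (S [ k ]≔ x) k ∣ ≡ odd ∣ below S k ∣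
  odd-∣below-self∣ S k x rewrite odd-∣below[]≔∣ S k k x | ≺ᵇ-irrefl k | ∧-zeroʳ x | ∧-zeroʳ (lookup S k) =
    xor-identityʳ _

  odd-∣below-toggle∣ : ∀ S k a x → lookup S a ≡ not x →
                       odd ∣ below (S [ a ]≔ x) k ∣ ≡ odd ∣ below S k ∣ xor (a ≺ᵇ k)
  odd-∣below-toggle∣ S k a x Sa≡¬x rewrite odd-∣below[]≔∣ S k a x | Sa≡¬x =
    cong (odd ∣ below S k ∣ xor_) (toggle x)
    where
    toggle : ∀ x → (x ∧ (a ≺ᵇ k)) xor (not x ∧ (a ≺ᵇ k)) ≡ (a ≺ᵇ k)
    toggle true  = xor-identityʳ _
    toggle false = refl

module Forms {c ℓ} (F : Field c ℓ) (n : ℕ) where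
  open Field F renaming (refl to ≈-refl; sym to ≈-sym; trans to ≈-trans)
  open Exterior F n
  open CommutativeSemigroupProperties *-commutativeSemigroup using () renaming (x∙yz≈y∙xz to *-x∙yz≈y∙xz)
  open CommutativeSemigroupProperties +-commutativeSemigroup using () renaming (interchange to +-interchange)
  open RingProperties ring using (-‿distribˡ-*; -‿distribʳ-*; -‿+-comm; -1*x≈-x; -‿involutive; -0#≈0#)

  sign : Bool → Carrier
  sign false = 1#
  sign true  = - 1#

  sign-not : ∀ b → sign (not b) ≈ - sign b
  sign-not false = ≈-refl
  sign-not true  = ≈-sym (-‿involutive 1#)

  signPow≈sign∘odd : ∀ r → signPow r ≈ sign (odd r)
  signPow≈sign∘odd zero    = ≈-refl
  signPow≈sign∘odd (suc r) = ≈-trans (-‿cong (signPow≈sign∘odd r)) (≈-sym (sign-not (odd r)))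

  -1*-1≈1 : - 1# * - 1# ≈ 1#
  -1*-1≈1 = ≈-trans (-1*x≈-x (- 1#)) (-‿involutive 1#)

  sign-xor : ∀ x y → sign (x xor y) ≈ sign x * sign y
  sign-xor false false = ≈-sym (*-identityˡ 1#)
  sign-xor false true  = ≈-sym (*-identityˡ (- 1#))
  sign-xor true  false = ≈-sym (*-identityʳ (- 1#))
  sign-xor true  true  = ≈-sym -1*-1≈1

  signPow-*-signPow : ∀ r s v → signPow r * (signPow s * v) ≈ sign (odd r xor odd s) * v
  signPow-*-signPow r s v = begin
    signPow r * (signPow s * v)               ≈⟨ *-assoc _ _ _ ⟨
    (signPow r * signPow s) * v               ≈⟨ *-congʳ (*-cong (signPow≈sign∘odd r) (signPow≈sign∘odd s)) ⟩
    (sign (odd r) * sign (odd s)) * v         ≈⟨ *-congʳ (sign-xor (odd r) (odd s)) ⟨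
    sign (odd r xor odd s) * v                ∎
    where open SetoidReasoning setoid

  signPow-cancel : ∀ r v → signPow r * (signPow r * v) ≈ v
  signPow-cancel r v = begin
    signPow r * (signPow r * v)   ≈⟨ signPow-*-signPow r r v ⟩
    sign (odd r xor odd r) * v    ≡⟨ cong (λ b → sign b * v) (xor-same (odd r)) ⟩
    1# * v                        ≈⟨ *-identityˡ v ⟩
    v                             ∎
    where open SetoidReasoning setoid

  signPow-swap : ∀ r s r′ s′ v → odd r xor odd s ≡ not (odd r′ xor odd s′) →
                 signPow r * (signPow s * v) ≈ - (signPow r′ * (signPow s′ * v))
  signPow-swap r s r′ s′ v parity = begin
    signPow r * (signPow s * v)             ≈⟨ signPow-*-signPow r s v ⟩
    sign (odd r xor odd s) * v              ≡⟨ cong (λ b → sign b * v) parity ⟩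
    sign (not (odd r′ xor odd s′)) * v      ≈⟨ *-congʳ (sign-not (odd r′ xor odd s′)) ⟩
    - sign (odd r′ xor odd s′) * v          ≈⟨ -‿distribˡ-* _ _ ⟨
    - (sign (odd r′ xor odd s′) * v)        ≈⟨ -‿cong (signPow-*-signPow r′ s′ v) ⟨
    - (signPow r′ * (signPow s′ * v))       ∎
    where open SetoidReasoning setoid

  -- Exchanging the roles of a and b shifts the counts below a and below b by [b < a] and
  -- [a < b]; exactly one of these is 1.
  wedge-wedge-parity : ∀ {a b} → a ≢ b → ∀ S → lookup S a ≡ true → lookup S b ≡ true →
    odd (countBelow a S) xor odd (countBelow b (S [ a ]≔ false)) ≡
      not (odd (countBelow b S) xor odd (countBelow a (S [ b ]≔ false)))
  wedge-wedge-parity {a} {b} a≢b S Sa Sb =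
    xor-swap′ {odd ∣ below S a ∣} {odd ∣ below S b ∣} (≺ᵇ-xor a≢b)
      refl (odd-∣below-toggle∣ S b a false Sa) refl (odd-∣below-toggle∣ S a b false Sb)

  partY-wedge-parity : ∀ {a b} → a ≢ b → ∀ T → lookup T a ≡ false → lookup T b ≡ true →
    odd (countBelow a (T [ a ]≔ true)) xor odd (countBelow b (T [ a ]≔ true)) ≡
      not (odd (countBelow b T) xor odd (countBelow a ((T [ b ]≔ false) [ a ]≔ true)))
  partY-wedge-parity {a} {b} a≢b T Ta Tb =
    xor-swap′ {odd ∣ below T a ∣} {odd ∣ below T b ∣} (≺ᵇ-xor a≢b)
      (odd-∣below-self∣ T a true) (odd-∣below-toggle∣ T b a true Ta) refl
      (trans (odd-∣below-self∣ (T [ b ]≔ false) a true) (odd-∣below-toggle∣ T a b false Tb))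

  partY-partY-parity : ∀ {a b} → a ≢ b → ∀ T → lookup T a ≡ false → lookup T b ≡ false →
    odd (countBelow a (T [ a ]≔ true)) xor odd (countBelow b ((T [ b ]≔ true) [ a ]≔ true)) ≡
      not (odd (countBelow b (T [ b ]≔ true)) xor odd (countBelow a ((T [ b ]≔ true) [ a ]≔ true)))
  partY-partY-parity {a} {b} a≢b T Ta Tb =
    xor-swap′ {odd ∣ below T a ∣} {odd ∣ below T b ∣} (≺ᵇ-xor a≢b) (odd-∣below-self∣ T a true)
      (trans (odd-∣below-toggle∣ (T [ b ]≔ true) b a true (trans (lookup∘update′ a≢b T true) Ta))
             (cong (_xor (a ≺ᵇ b)) (odd-∣below-self∣ T b true)))
      (odd-∣below-self∣ T b true)
      (trans (odd-∣below-self∣ (T [ b ]≔ true) a true) (odd-∣below-toggle∣ T a b true Tb))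

  ≐-refl : ∀ {u} → u ≐ u
  ≐-refl S = ≈-refl

  ≐-sym : ∀ {u v} → u ≐ v → v ≐ u
  ≐-sym u≐v S = ≈-sym (u≐v S)

  ≐-trans : ∀ {u v w} → u ≐ v → v ≐ w → u ≐ w
  ≐-trans u≐v v≐w S = ≈-trans (u≐v S) (v≐w S)

  ≐-setoid : Setoid c ℓ
  ≐-setoid = record
    { Carrier = Form ; _≈_ = _≐_
    ; isEquivalence = record { refl = ≐-refl ; sym = ≐-sym ; trans = ≐-trans } }

  module ≐-Reasoning = SetoidReasoning ≐-setoid

  negF : Form → Form
  negF u S = - u S

  _-F_ : Form → Form → Form
  u -F v = u +F negF v

  -- m = partX j m + e_j ∧ partY j m; NRel i j m r says r ≐ shift j i m, or r ≐ ePart j m when that vanishes.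
  ePart : Fin n → Form → Form
  ePart j m = wedge j (partY j m)

  transfer : Fin n → Fin n → Form → Form
  transfer j i m = wedge i (partY j m)

  shift : Fin n → Fin n → Form → Form
  shift j i m = partX j m +F transfer j i m

  +F-cong : ∀ {u u′ v v′} → u ≐ u′ → v ≐ v′ → (u +F v) ≐ (u′ +F v′)
  +F-cong u≐u′ v≐v′ S = +-cong (u≐u′ S) (v≐v′ S)

  negF-cong : ∀ {u v} → u ≐ v → negF u ≐ negF v
  negF-cong u≐v S = -‿cong (u≐v S)

  negF-involutive : ∀ u → negF (negF u) ≐ u
  negF-involutive u S = -‿involutive (u S)

  +F-identityʳ : ∀ u → (u +F zeroF) ≐ u
  +F-identityʳ u S = +-identityʳ (u S)

  +F-identityˡ : ∀ u → (zeroF +F u) ≐ u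
  +F-identityˡ u S = +-identityˡ (u S)

  negF-zero : negF zeroF ≐ zeroF
  negF-zero S = -0#≈0#

  -F-self : ∀ {u v} → u ≐ v → (u -F v) ≐ zeroF
  -F-self {u} {v} u≐v S = ≈-trans (+-congʳ (u≐v S)) (-‿inverseʳ (v S))

  +F≐0⇒≐negF : ∀ {u v} → (u +F v) ≐ zeroF → v ≐ negF u
  +F≐0⇒≐negF {u} {v} u+v≐0 S = begin
    v S                   ≈⟨ +-identityˡ (v S) ⟨
    0# + v S              ≈⟨ +-congʳ (-‿inverseˡ (u S)) ⟨
    (- u S + u S) + v S   ≈⟨ +-assoc _ _ _ ⟩
    - u S + (u S + v S)   ≈⟨ +-congˡ (u+v≐0 S) ⟩
    - u S + 0#            ≈⟨ +-identityʳ _ ⟩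
    - u S                 ∎
    where open SetoidReasoning setoid

  partX-wedge : ∀ j y → partX j (wedge j y) ≐ zeroF
  partX-wedge j y S with lookup S j
  ... | true  = ≈-refl
  ... | false = ≈-refl

  partY-partX : ∀ j m → partY j (partX j m) ≐ zeroF
  partY-partX j m T rewrite lookup∘update j T true with lookup T j
  ... | true  = ≈-refl
  ... | false = zeroʳ _

  partX-idem : ∀ j m → partX j (partX j m) ≐ partX j m
  partX-idem j m S with lookup S j
  ... | true  = ≈-refl
  ... | false = ≈-refl

  partX-partY : ∀ j m → partX j (partY j m) ≐ partY j m
  partX-partY j m T with lookup T j
  ... | true  = ≈-refl
  ... | false = ≈-refl

  wedge-partX : ∀ j y → wedge j (partX j y) ≐ wedge j y
  wedge-partX j y S rewrite lookup∘update j S false = ≈-refl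

  wedge-self : ∀ j y → wedge j (wedge j y) ≐ zeroF
  wedge-self j y S rewrite lookup∘update j S false with lookup S j
  ... | true  = zeroʳ _
  ... | false = ≈-refl

  ePart+partX : ∀ j m → (ePart j m +F partX j m) ≐ m
  ePart+partX j m S
    rewrite lookup∘update j S false | []≔-idempotent {x = false} {y = true} S j
    with lookup S j in Sj
  ... | true rewrite trans (cong (S [ j ]≔_) (sym Sj)) ([]≔-lookup S j) =
        ≈-trans (+-identityʳ _) (signPow-cancel (countBelow j S) (m S))
  ... | false = +-identityˡ _

  partY-wedge : ∀ j y → partY j (wedge j y) ≐ partX j y
  partY-wedge j y T
    rewrite lookup∘update j T true | []≔-idempotent {x = true} {y = false} T j
    with lookup T j in Tj
  ... | true = ≈-refl
  ... | false rewrite trans (cong (T [ j ]≔_) (sym Tj)) ([]≔-lookup T j) =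
        signPow-cancel (countBelow j (T [ j ]≔ true)) (y T)

  partX-comm : ∀ k j m → partX k (partX j m) ≐ partX j (partX k m)
  partX-comm k j m S with lookup S k | lookup S j
  ... | true  | true  = ≈-refl
  ... | true  | false = ≈-refl
  ... | false | true  = ≈-refl
  ... | false | false = ≈-refl

  partX-wedge-comm : ∀ {k a} → k ≢ a → ∀ y → partX k (wedge a y) ≐ wedge a (partX k y)
  partX-wedge-comm {k} {a} k≢a y S rewrite lookup∘update′ k≢a S false with lookup S k | lookup S a
  ... | true  | true  = ≈-sym (zeroʳ _)
  ... | true  | false = ≈-refl
  ... | false | true  = ≈-refl
  ... | false | false = ≈-refl

  partX-partY-comm : ∀ {k a} → k ≢ a → ∀ m → partX k (partY a m) ≐ partY a (partX k m)
  partX-partY-comm {k} {a} k≢a m T rewrite lookup∘update′ k≢a T true with lookup T k | lookup T a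
  ... | true  | true  = ≈-refl
  ... | true  | false = ≈-sym (zeroʳ _)
  ... | false | true  = ≈-refl
  ... | false | false = ≈-refl

  partY-wedge-anticomm : ∀ {a b} → a ≢ b → ∀ y → partY a (wedge b y) ≐ negF (wedge b (partY a y))
  partY-wedge-anticomm {a} {b} a≢b y T
    rewrite lookup∘update′ (a≢b ∘ sym) T inside | lookup∘update′ a≢b T outside
    with lookup T a in Ta | lookup T b in Tb
  ... | true  | true  = ≈-sym (≈-trans (-‿cong (zeroʳ _)) -0#≈0#)
  ... | true  | false = ≈-sym -0#≈0#
  ... | false | false = ≈-trans (zeroʳ _) (≈-sym -0#≈0#)
  ... | false | true rewrite []≔-commutes {x = true} {y = false} T a b a≢b =
        signPow-swap (countBelow a (T [ a ]≔ true)) (countBelow b (T [ a ]≔ true)) (countBelow b T)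
                     (countBelow a ((T [ b ]≔ false) [ a ]≔ true)) _ (partY-wedge-parity a≢b T Ta Tb)

  wedge-anticomm : ∀ {a b} → a ≢ b → ∀ y → wedge a (wedge b y) ≐ negF (wedge b (wedge a y))
  wedge-anticomm {a} {b} a≢b y S
    rewrite lookup∘update′ (a≢b ∘ sym) S false | lookup∘update′ a≢b S false
    with lookup S a in Sa | lookup S b in Sb
  ... | true  | true rewrite []≔-commutes {x = false} {y = false} S a b a≢b =
        signPow-swap (countBelow a S) (countBelow b (S [ a ]≔ false)) (countBelow b S)
                     (countBelow a (S [ b ]≔ false)) _ (wedge-wedge-parity a≢b S Sa Sb)
  ... | true  | false = ≈-trans (zeroʳ _) (≈-sym -0#≈0#)
  ... | false | true  = ≈-sym (≈-trans (-‿cong (zeroʳ _)) -0#≈0#)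
  ... | false | false = ≈-sym -0#≈0#

  partY-anticomm : ∀ {a b} → a ≢ b → ∀ m → partY a (partY b m) ≐ negF (partY b (partY a m))
  partY-anticomm {a} {b} a≢b m T
    rewrite lookup∘update′ (a≢b ∘ sym) T true | lookup∘update′ a≢b T true
    with lookup T a in Ta | lookup T b in Tb
  ... | false | false rewrite []≔-commutes {x = true} {y = true} T a b a≢b =
        signPow-swap (countBelow a (T [ a ]≔ true)) (countBelow b ((T [ b ]≔ true) [ a ]≔ true))
                     (countBelow b (T [ b ]≔ true)) (countBelow a ((T [ b ]≔ true) [ a ]≔ true)) _
                     (partY-partY-parity a≢b T Ta Tb)
  ... | true  | true  = ≈-sym -0#≈0#
  ... | true  | false = ≈-sym (≈-trans (-‿cong (zeroʳ _)) -0#≈0#)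
  ... | false | true  = ≈-trans (zeroʳ _) (≈-sym -0#≈0#)

  partX-cong : ∀ j {u v} → u ≐ v → partX j u ≐ partX j v
  partX-cong j u≐v S with lookup S j
  ... | true  = ≈-refl
  ... | false = u≐v S

  partY-cong : ∀ j {u v} → u ≐ v → partY j u ≐ partY j v
  partY-cong j u≐v S with lookup S j
  ... | true  = ≈-refl
  ... | false = *-congˡ (u≐v _)

  wedge-cong : ∀ j {u v} → u ≐ v → wedge j u ≐ wedge j v
  wedge-cong j u≐v S with lookup S j
  ... | true  = *-congˡ (u≐v _)
  ... | false = ≈-refl

  record IsLinear (f : Form → Form) : Set (c ⊔ ℓ) where
    field
      ≐-resp  : ∀ {u v} → u ≐ v → f u ≐ f v
      +F-homo : ∀ u v → f (u +F v) ≐ (f u +F f v)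
      ·F-homo : ∀ a u → f (a ·F u) ≐ (a ·F f u)

    zeroF-homo : f zeroF ≐ zeroF
    zeroF-homo = ≐-trans (≐-resp (λ _ → ≈-sym (zeroˡ 0#))) (≐-trans (·F-homo 0# zeroF) (λ _ → zeroˡ _))

    negF-homo : ∀ u → f (negF u) ≐ negF (f u)
    negF-homo u = ≐-trans (≐-resp (λ S → ≈-sym (-1*x≈-x (u S)))) (≐-trans (·F-homo (- 1#) u) (λ _ → -1*x≈-x _))

    ≐zeroF⇒≐zeroF : ∀ {u} → u ≐ zeroF → f u ≐ zeroF
    ≐zeroF⇒≐zeroF u≈0 = ≐-trans (≐-resp u≈0) zeroF-homo

    -F-homo : ∀ u v → f (u -F v) ≐ (f u -F f v)
    -F-homo u v = ≐-trans (+F-homo u (negF v)) (+F-cong ≐-refl (negF-homo v))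

  open IsLinear public

  partX-linear : ∀ j → IsLinear (partX j)
  partX-linear j = record { ≐-resp = partX-cong j ; +F-homo = additive ; ·F-homo = homogeneous }
    where
    additive : ∀ u v → partX j (u +F v) ≐ (partX j u +F partX j v)
    additive u v S with lookup S j
    ... | true  = ≈-sym (+-identityʳ _)
    ... | false = ≈-refl
    homogeneous : ∀ a u → partX j (a ·F u) ≐ (a ·F partX j u)
    homogeneous a u S with lookup S j
    ... | true  = ≈-sym (zeroʳ _)
    ... | false = ≈-refl

  partY-linear : ∀ j → IsLinear (partY j)
  partY-linear j = record { ≐-resp = partY-cong j ; +F-homo = additive ; ·F-homo = homogeneous }
    where
    additive : ∀ u v → partY j (u +F v) ≐ (partY j u +F partY j v)
    additive u v S with lookup S j
    ... | true  = ≈-sym (+-identityʳ _)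
    ... | false = distribˡ _ _ _
    homogeneous : ∀ a u → partY j (a ·F u) ≐ (a ·F partY j u)
    homogeneous a u S with lookup S j
    ... | true  = ≈-sym (zeroʳ _)
    ... | false = *-x∙yz≈y∙xz _ _ _

  wedge-linear : ∀ j → IsLinear (wedge j)
  wedge-linear j = record { ≐-resp = wedge-cong j ; +F-homo = additive ; ·F-homo = homogeneous }
    where
    additive : ∀ u v → wedge j (u +F v) ≐ (wedge j u +F wedge j v)
    additive u v S with lookup S j
    ... | true  = distribˡ _ _ _
    ... | false = ≈-sym (+-identityʳ _)
    homogeneous : ∀ a u → wedge j (a ·F u) ≐ (a ·F wedge j u)
    homogeneous a u S with lookup S j
    ... | true  = *-x∙yz≈y∙xz _ _ _
    ... | false = ≈-sym (zeroʳ _)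

  id-linear : IsLinear (λ u → u)
  id-linear = record { ≐-resp = λ u≐v → u≐v ; +F-homo = λ _ _ → ≐-refl ; ·F-homo = λ _ _ → ≐-refl }

  negF-linear : IsLinear negF
  negF-linear = record
    { ≐-resp = negF-cong ; +F-homo = λ _ _ _ → ≈-sym (-‿+-comm _ _) ; ·F-homo = λ _ _ _ → -‿distribʳ-* _ _ }

  ∘-linear : ∀ {f g} → IsLinear f → IsLinear g → IsLinear (f ∘ g)
  ∘-linear f-lin g-lin = record
    { ≐-resp  = ≐-resp f-lin ∘ ≐-resp g-lin
    ; +F-homo = λ u v → ≐-trans (≐-resp f-lin (+F-homo g-lin u v)) (+F-homo f-lin _ _)
    ; ·F-homo = λ a u → ≐-trans (≐-resp f-lin (·F-homo g-lin a u)) (·F-homo f-lin _ _) }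

  +F-linear : ∀ {f g} → IsLinear f → IsLinear g → IsLinear (λ u → f u +F g u)
  +F-linear f-lin g-lin = record
    { ≐-resp  = λ u≐v → +F-cong (≐-resp f-lin u≐v) (≐-resp g-lin u≐v)
    ; +F-homo = λ u v S → ≈-trans (+-cong (+F-homo f-lin u v S) (+F-homo g-lin u v S)) (+-interchange _ _ _ _)
    ; ·F-homo = λ a u S → ≈-trans (+-cong (·F-homo f-lin a u S) (·F-homo g-lin a u S)) (≈-sym (distribˡ _ _ _)) }

  ePart-linear : ∀ j → IsLinear (ePart j)
  ePart-linear j = ∘-linear (wedge-linear j) (partY-linear j)

  transfer-linear : ∀ j i → IsLinear (transfer j i)
  transfer-linear j i = ∘-linear (wedge-linear i) (partY-linear j)

  shift-linear : ∀ j i → IsLinear (shift j i)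
  shift-linear j i = +F-linear (partX-linear j) (transfer-linear j i)

  partY-ePart : ∀ j m → partY j (ePart j m) ≐ partY j m
  partY-ePart j m = ≐-trans (partY-wedge j (partY j m)) (partX-partY j m)

  transfer-ePart : ∀ j i m → transfer j i (ePart j m) ≐ transfer j i m
  transfer-ePart j i m = wedge-cong i (partY-ePart j m)

  partY-self : ∀ j m → partY j (partY j m) ≐ zeroF
  partY-self j m = ≐-trans (partY-cong j (≐-sym (partX-partY j m))) (partY-partX j (partY j m))

  partX-transfer : ∀ {j i} → i ≢ j → ∀ m → partX j (transfer j i m) ≐ transfer j i m
  partX-transfer {j} {i} i≢j m = ≐-trans (partX-wedge-comm (i≢j ∘ sym) (partY j m)) (wedge-cong i (partX-partY j m))

  partY-transfer : ∀ {j i} → i ≢ j → ∀ m → partY j (transfer j i m) ≐ zeroF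
  partY-transfer {j} {i} i≢j m =
    ≐-trans (partY-wedge-anticomm (i≢j ∘ sym) (partY j m))
    (≐-trans (negF-cong (≐-trans (wedge-cong i (partY-self j m)) (zeroF-homo (wedge-linear i)))) negF-zero)

  partX-shift : ∀ {j i} → i ≢ j → ∀ m → partX j (shift j i m) ≐ shift j i m
  partX-shift {j} {i} i≢j m =
    ≐-trans (+F-homo (partX-linear j) (partX j m) (transfer j i m)) (+F-cong (partX-idem j m) (partX-transfer i≢j m))

  partY-shift : ∀ {j i} → i ≢ j → ∀ m → partY j (shift j i m) ≐ zeroF
  partY-shift {j} {i} i≢j m =
    ≐-trans (+F-homo (partY-linear j) (partX j m) (transfer j i m))
    (≐-trans (+F-cong (partY-partX j m) (partY-transfer i≢j m)) (+F-identityʳ zeroF))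

  transfer-shift : ∀ {j i} i′ → i ≢ j → ∀ m → transfer j i′ (shift j i m) ≐ zeroF
  transfer-shift i′ i≢j m = ≐-trans (wedge-cong i′ (partY-shift i≢j m)) (zeroF-homo (wedge-linear i′))

  shift-fixes : ∀ j i {u} → partX j u ≐ u → shift j i u ≐ u
  shift-fixes j i {u} Xu≐u =
    ≐-trans (+F-cong Xu≐u (≐-trans (wedge-cong i (≐-trans (partY-cong j (≐-sym Xu≐u)) (partY-partX j u)))
                                   (zeroF-homo (wedge-linear i))))
            (+F-identityʳ u)

  shift-partX : ∀ j i m → shift j i (partX j m) ≐ partX j m
  shift-partX j i m = shift-fixes j i (partX-idem j m)

  shift≐0⇒transfer≐-partX : ∀ j i m → shift j i m ≐ zeroF → transfer j i m ≐ negF (partX j m)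
  shift≐0⇒transfer≐-partX j i m = +F≐0⇒≐negF

  wedge-partY-wedge : ∀ {a b} → b ≢ a → ∀ y → wedge a (partY b (wedge a y)) ≐ zeroF
  wedge-partY-wedge {a} {b} b≢a y =
    ≐-trans (wedge-cong a (partY-wedge-anticomm b≢a y))
    (≐-trans (negF-homo (wedge-linear a) (wedge a (partY b y)))
    (≐-trans (negF-cong (wedge-self a (partY b y))) negF-zero))

  transfer-comm : ∀ {a b c d} → b ≢ c → a ≢ c → b ≢ d → d ≢ a → ∀ m →
                  transfer b a (transfer d c m) ≐ transfer d c (transfer b a m)
  transfer-comm {a} {b} {c} {d} b≢c a≢c b≢d d≢a m = begin
    wedge a (partY b (wedge c (partY d m)))       ≈⟨ wedge-cong a (partY-wedge-anticomm b≢c (partY d m)) ⟩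
    wedge a (negF (wedge c (partY b (partY d m)))) ≈⟨ negF-homo (wedge-linear a) (wedge c (partY b (partY d m))) ⟩
    negF (wedge a (wedge c (partY b (partY d m)))) ≈⟨ negF-cong (wedge-anticomm a≢c (partY b (partY d m))) ⟩
    negF (negF (wedge c (wedge a (partY b (partY d m))))) ≈⟨ negF-involutive (wedge c (wedge a (partY b (partY d m)))) ⟩
    wedge c (wedge a (partY b (partY d m)))       ≈⟨ wedge-cong c (wedge-cong a (partY-anticomm b≢d m)) ⟩
    wedge c (wedge a (negF (partY d (partY b m)))) ≈⟨ wedge-cong c (negF-homo (wedge-linear a) (partY d (partY b m))) ⟩
    wedge c (negF (wedge a (partY d (partY b m)))) ≈⟨ wedge-cong c (partY-wedge-anticomm d≢a (partY b m)) ⟨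
    wedge c (partY d (wedge a (partY b m)))       ∎
    where open ≐-Reasoning

  partX-transfer-comm : ∀ {k j i} → k ≢ i → k ≢ j → ∀ m → partX k (transfer j i m) ≐ transfer j i (partX k m)
  partX-transfer-comm {k} {j} {i} k≢i k≢j m =
    ≐-trans (partX-wedge-comm k≢i (partY j m)) (wedge-cong i (partX-partY-comm k≢j m))

  partX-shift-comm : ∀ {k j i} → k ≢ i → k ≢ j → ∀ m → partX k (shift j i m) ≐ shift j i (partX k m)
  partX-shift-comm {k} {j} {i} k≢i k≢j m =
    ≐-trans (+F-homo (partX-linear k) (partX j m) (transfer j i m))
            (+F-cong (partX-comm k j m) (partX-transfer-comm k≢i k≢j m))

  transfer-shift-comm : ∀ {j i j′ i′} → j ≢ i′ → j ≢ j′ → i ≢ i′ → i ≢ j′ → ∀ m →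
                        transfer j′ i′ (shift j i m) ≐ shift j i (transfer j′ i′ m)
  transfer-shift-comm {j} {i} {j′} {i′} j≢i′ j≢j′ i≢i′ i≢j′ m =
    ≐-trans (+F-homo (transfer-linear j′ i′) (partX j m) (transfer j i m))
      (+F-cong (≐-sym (partX-transfer-comm j≢i′ j≢j′ m))
               (transfer-comm (i≢j′ ∘ sym) (i≢i′ ∘ sym) (j≢j′ ∘ sym) j≢i′ m))

  transfer-shift-comm-sameTarget : ∀ {j i j′} → j ≢ i → j ≢ j′ → j′ ≢ i → ∀ m →
                                   transfer j′ i (shift j i m) ≐ shift j i (transfer j′ i m)
  transfer-shift-comm-sameTarget {j} {i} {j′} j≢i j≢j′ j′≢i m = begin
    transfer j′ i (partX j m +F transfer j i m)
      ≈⟨ +F-homo (transfer-linear j′ i) (partX j m) (transfer j i m) ⟩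
    transfer j′ i (partX j m) +F transfer j′ i (transfer j i m)
      ≈⟨ +F-cong (≐-sym (partX-transfer-comm j≢i j≢j′ m)) (wedge-partY-wedge j′≢i (partY j m)) ⟩
    partX j (transfer j′ i m) +F zeroF
      ≈⟨ +F-cong ≐-refl (wedge-partY-wedge j≢i (partY j′ m)) ⟨
    partX j (transfer j′ i m) +F transfer j i (transfer j′ i m) ∎
    where open ≐-Reasoning

  transfer-ePart-comm : ∀ {j j′ i′} → j ≢ i′ → j ≢ j′ → ∀ m →
                        transfer j′ i′ (ePart j m) ≐ ePart j (transfer j′ i′ m)
  transfer-ePart-comm j≢i′ j≢j′ m = transfer-comm (j≢j′ ∘ sym) (j≢i′ ∘ sym) (j≢j′ ∘ sym) j≢i′ m

  ePart≐-partX : ∀ j m → ePart j m ≐ (m -F partX j m)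
  ePart≐-partX j m S = begin
    ePart j m S                                ≈⟨ +-identityʳ _ ⟨
    ePart j m S + 0#                           ≈⟨ +-congˡ (-‿inverseʳ (partX j m S)) ⟨
    ePart j m S + (partX j m S + - partX j m S) ≈⟨ +-assoc _ _ _ ⟨
    (ePart j m S + partX j m S) + - partX j m S ≈⟨ +-congʳ (ePart+partX j m S) ⟩
    m S + - partX j m S                        ∎
    where open SetoidReasoning setoid

  ePart-idem : ∀ j m → ePart j (ePart j m) ≐ ePart j m
  ePart-idem j m = wedge-cong j (partY-ePart j m)

  ePart-transfer : ∀ {j i} → i ≢ j → ∀ m → ePart j (transfer j i m) ≐ zeroF
  ePart-transfer {j} i≢j m = ≐-trans (wedge-cong j (partY-transfer i≢j m)) (zeroF-homo (wedge-linear j))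

  shift-ePart : ∀ j i m → shift j i (ePart j m) ≐ transfer j i m
  shift-ePart j i m = ≐-trans (+F-cong (partX-wedge j (partY j m)) (transfer-ePart j i m)) (+F-identityˡ _)

  shift-transfer : ∀ {j i} → i ≢ j → ∀ m → shift j i (transfer j i m) ≐ transfer j i m
  shift-transfer {j} {i} i≢j m =
    ≐-trans (+F-cong (partX-transfer i≢j m) (wedge-partY-wedge (i≢j ∘ sym) (partY j m))) (+F-identityʳ _)

  shift-ePart-transfer : ∀ {j i} → i ≢ j → ∀ g → shift j i (ePart j g -F transfer j i g) ≐ zeroF
  shift-ePart-transfer {j} {i} i≢j g =
    ≐-trans (-F-homo (shift-linear j i) (ePart j g) (transfer j i g))
            (-F-self (≐-trans (shift-ePart j i g) (≐-sym (shift-transfer i≢j g))))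

  ePart-ePart-transfer : ∀ {j i} → i ≢ j → ∀ g → ePart j (ePart j g -F transfer j i g) ≐ ePart j g
  ePart-ePart-transfer {j} {i} i≢j g =
    ≐-trans (-F-homo (ePart-linear j) (ePart j g) (transfer j i g))
    (≐-trans (+F-cong (ePart-idem j g) (≐-trans (negF-cong (ePart-transfer i≢j g)) negF-zero)) (+F-identityʳ _))

  shift-transfer-difference : ∀ {j i} j′ → j ≢ i → ∀ g → shift j i (transfer j′ j g -F transfer j′ i g) ≐ zeroF
  shift-transfer-difference {j} {i} j′ j≢i g =
    ≐-trans (-F-homo (shift-linear j i) (transfer j′ j g) (transfer j′ i g))
            (-F-self (≐-trans shift-T₁ (≐-sym shift-T₂)))
    where
    shift-T₁ : shift j i (transfer j′ j g) ≐ wedge i (partX j (partY j′ g))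
    shift-T₁ = ≐-trans (+F-cong (partX-wedge j (partY j′ g)) (wedge-cong i (partY-wedge j (partY j′ g))))
                       (+F-identityˡ _)
    shift-T₂ : shift j i (transfer j′ i g) ≐ wedge i (partX j (partY j′ g))
    shift-T₂ = ≐-trans (+F-cong (partX-wedge-comm j≢i (partY j′ g)) (wedge-partY-wedge j≢i (partY j′ g)))
                       (+F-identityʳ _)

  ePart-transfer-difference : ∀ {j i j′} → j ≢ i → j′ ≢ j → j′ ≢ i → ∀ g →
                              ePart j (transfer j′ j g -F transfer j′ i g) ≐ transfer j′ j (shift j i g)
  ePart-transfer-difference {j} {i} {j′} j≢i j′≢j j′≢i g = begin
    ePart j (transfer j′ j g -F transfer j′ i g)
      ≈⟨ -F-homo (ePart-linear j) (transfer j′ j g) (transfer j′ i g) ⟩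
    ePart j (transfer j′ j g) -F ePart j (transfer j′ i g)
      ≈⟨ +F-cong (≐-trans (wedge-cong j (partY-wedge j (partY j′ g))) (wedge-partX j (partY j′ g)))
                 (negF-cong (≐-sym (transfer-ePart-comm j≢i (j′≢j ∘ sym) g))) ⟩
    transfer j′ j g -F transfer j′ i (ePart j g)
      ≈⟨ +F-cong T-drops-ePart (≐-sym T-transfer) ⟩
    transfer j′ j (partX j g) +F transfer j′ j (transfer j i g)
      ≈⟨ +F-homo (transfer-linear j′ j) (partX j g) (transfer j i g) ⟨
    transfer j′ j (shift j i g) ∎
    where
    open ≐-Reasoning
    T-drops-ePart : transfer j′ j g ≐ transfer j′ j (partX j g)
    T-drops-ePart = ≐-trans (≐-resp (transfer-linear j′ j) (≐-sym (ePart+partX j g)))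
                    (≐-trans (+F-homo (transfer-linear j′ j) (ePart j g) (partX j g))
                    (≐-trans (+F-cong (wedge-partY-wedge j′≢j (partY j g)) ≐-refl) (+F-identityˡ _)))
    T-transfer : transfer j′ j (transfer j i g) ≐ negF (transfer j′ i (ePart j g))
    T-transfer = begin
      wedge j (partY j′ (wedge i (partY j g)))  ≈⟨ wedge-cong j (partY-wedge-anticomm j′≢i (partY j g)) ⟩
      wedge j (negF (wedge i y))                ≈⟨ negF-homo (wedge-linear j) (wedge i y) ⟩
      negF (wedge j (wedge i y))                ≈⟨ negF-cong (wedge-anticomm (j≢i) y) ⟩
      negF (negF (wedge i (wedge j y)))         ≈⟨ negF-cong (negF-homo (wedge-linear i) (wedge j y)) ⟨
      negF (wedge i (negF (wedge j y)))         ≈⟨ negF-cong (wedge-cong i (partY-wedge-anticomm j′≢j (partY j g))) ⟨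
      negF (wedge i (partY j′ (wedge j (partY j g)))) ∎
      where y = partY j′ (partY j g)

allSubsets : ∀ n → List (Subset n)
allSubsets zero    = [] ∷ []
allSubsets (suc n) = map (true ∷_) (allSubsets n) ++ map (false ∷_) (allSubsets n)

∈-allSubsets : ∀ {n} (S : Subset n) → S ∈ₗ allSubsets n
∈-allSubsets []          = here refl
∈-allSubsets (true ∷ S)  = ∈-++⁺ˡ (∈-map⁺ (true ∷_) (∈-allSubsets S))
∈-allSubsets (false ∷ S) = ∈-++⁺ʳ (map (true ∷_) (allSubsets _)) (∈-map⁺ (false ∷_) (∈-allSubsets S))

module Subspaces {c ℓ} (F : Field c ℓ) (n : ℕ) where
  open Field F renaming (refl to ≈-refl; sym to ≈-sym; trans to ≈-trans)
  open Exterior F n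
  open Forms F n
  open CommutativeSemigroupProperties +-commutativeSemigroup using () renaming (interchange to +-interchange)
  open RingProperties ring using (-1*x≈-x; -0#≈0#)

  record IsSubspace (L : Sub) : Set (c ⊔ ℓ) where
    field
      ≐-closed  : ∀ {u v} → u ≐ v → L u → L v
      zeroF∈    : L zeroF
      +F-closed : ∀ {u v} → L u → L v → L (u +F v)
      ·F-closed : ∀ a {u} → L u → L (a ·F u)

    negF-closed : ∀ {u} → L u → L (negF u)
    negF-closed {u} u∈L = ≐-closed (λ S → -1*x≈-x (u S)) (·F-closed (- 1#) u∈L)

    -F-closed : ∀ {u v} → L u → L v → L (u -F v)
    -F-closed u∈L v∈L = +F-closed u∈L (negF-closed v∈L)

  open IsSubspace public

  ≡ₛ-sym : ∀ {L L′} → L ≡ₛ L′ → L′ ≡ₛ L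
  ≡ₛ-sym L≡L′ v = proj₂ (L≡L′ v) , proj₁ (L≡L′ v)

  ≡ₛ-trans : ∀ {L L′ L″} → L ≡ₛ L′ → L′ ≡ₛ L″ → L ≡ₛ L″
  ≡ₛ-trans L≡L′ L′≡L″ v = proj₁ (L′≡L″ v) ∘ proj₁ (L≡L′ v) , proj₂ (L≡L′ v) ∘ proj₂ (L′≡L″ v)

  IsSubspace-resp-≡ₛ : ∀ {L L′} → L ≡ₛ L′ → IsSubspace L → IsSubspace L′
  IsSubspace-resp-≡ₛ {L} {L′} L≡L′ L-sub = record
    { ≐-closed  = λ u≐v u∈L′ → to (≐-closed L-sub u≐v (from u∈L′))
    ; zeroF∈    = to (zeroF∈ L-sub)
    ; +F-closed = λ u∈L′ v∈L′ → to (+F-closed L-sub (from u∈L′) (from v∈L′))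
    ; ·F-closed = λ a u∈L′ → to (·F-closed L-sub a (from u∈L′)) }
    where
    to : ∀ {v} → L v → L′ v
    to {v} = proj₁ (L≡L′ v)
    from : ∀ {v} → L′ v → L v
    from {v} = proj₂ (L≡L′ v)

  linComb-++ : ∀ cs ds → linComb (cs ++ ds) ≐ (linComb cs +F linComb ds)
  linComb-++ []             ds S = ≈-sym (+-identityˡ _)
  linComb-++ ((a , w) ∷ cs) ds S = ≈-trans (+-congˡ (linComb-++ cs ds S)) (≈-sym (+-assoc _ _ _))

  scaleCoeffs : Carrier → List (Carrier × Form) → List (Carrier × Form)
  scaleCoeffs a = map (λ (b , w) → a * b , w)

  linComb-scale : ∀ a cs → linComb (scaleCoeffs a cs) ≐ (a ·F linComb cs)
  linComb-scale a []             S = ≈-sym (zeroʳ a)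
  linComb-scale a ((b , w) ∷ cs) S =
    ≈-trans (+-cong (*-assoc a b (w S)) (linComb-scale a cs S)) (≈-sym (distribˡ _ _ _))

  AllSnd-++ : ∀ {P cs ds} → AllSnd P cs → AllSnd P ds → AllSnd P (cs ++ ds)
  AllSnd-++ []         qs = qs
  AllSnd-++ (p ∷ ps) qs = p ∷ AllSnd-++ ps qs

  AllSnd-scale : ∀ {P} a {cs} → AllSnd P cs → AllSnd P (scaleCoeffs a cs)
  AllSnd-scale a []       = []
  AllSnd-scale a (p ∷ ps) = p ∷ AllSnd-scale a ps

  Span-isSubspace : ∀ P → IsSubspace (Span P)
  Span-isSubspace P = record
    { ≐-closed  = λ { u≐v (cs , ps , u≐cs) → cs , ps , ≐-trans (≐-sym u≐v) u≐cs }
    ; zeroF∈    = [] , [] , ≐-refl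
    ; +F-closed = λ { (cs , ps , u≐cs) (ds , qs , v≐ds) →
                      cs ++ ds , AllSnd-++ ps qs , ≐-trans (+F-cong u≐cs v≐ds) (≐-sym (linComb-++ cs ds)) }
    ; ·F-closed = λ { a (cs , ps , u≐cs) →
                      scaleCoeffs a cs , AllSnd-scale a ps ,
                      ≐-trans (λ S → *-congˡ (u≐cs S)) (≐-sym (linComb-scale a cs)) } }

  Span-least : ∀ {P L} → IsSubspace L → (∀ {v} → P v → L v) → ∀ {v} → Span P v → L v
  Span-least {P} {L} L-sub P⊆L (cs , ps , v≐cs) = ≐-closed L-sub (≐-sym v≐cs) (combine cs ps)
    where
    combine : ∀ cs → AllSnd P cs → L (linComb cs)
    combine []             []       = zeroF∈ L-sub
    combine ((a , w) ∷ cs) (p ∷ ps) = +F-closed L-sub (·F-closed L-sub a (P⊆L p)) (combine cs ps)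

  Span-generator : ∀ {P v} → P v → Span P v
  Span-generator p = (1# , _) ∷ [] , p ∷ [] , λ S → ≈-sym (≈-trans (+-identityʳ _) (*-identityˡ _))

  preimage-isSubspace : ∀ {f M} → IsLinear f → IsSubspace M → IsSubspace (M ∘ f)
  preimage-isSubspace f-lin M-sub = record
    { ≐-closed  = λ u≐v → ≐-closed M-sub (≐-resp f-lin u≐v)
    ; zeroF∈    = ≐-closed M-sub (≐-sym (zeroF-homo f-lin)) (zeroF∈ M-sub)
    ; +F-closed = λ fu∈M fv∈M → ≐-closed M-sub (≐-sym (+F-homo f-lin _ _)) (+F-closed M-sub fu∈M fv∈M)
    ; ·F-closed = λ a fu∈M → ≐-closed M-sub (≐-sym (·F-homo f-lin a _)) (·F-closed M-sub a fu∈M) }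

  addCoeffs : List Carrier → List Carrier → List Carrier
  addCoeffs []       bs       = bs
  addCoeffs (a ∷ as) []       = a ∷ as
  addCoeffs (a ∷ as) (b ∷ bs) = (a + b) ∷ addCoeffs as bs

  linCombL-add : ∀ as bs G → linCombL (addCoeffs as bs) G ≐ (linCombL as G +F linCombL bs G)
  linCombL-add []       bs       G       S = ≈-sym (+-identityˡ _)
  linCombL-add (a ∷ as) []       []      S = ≈-sym (+-identityʳ _)
  linCombL-add (a ∷ as) []       (g ∷ G) S = ≈-sym (+-identityʳ _)
  linCombL-add (a ∷ as) (b ∷ bs) []      S = ≈-sym (+-identityʳ _)
  linCombL-add (a ∷ as) (b ∷ bs) (g ∷ G) S =
    ≈-trans (+-cong (distribʳ (g S) a b) (linCombL-add as bs G S)) (+-interchange _ _ _ _)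

  linCombL-scale : ∀ x as G → linCombL (map (x *_) as) G ≐ (x ·F linCombL as G)
  linCombL-scale x []       G       S = ≈-sym (zeroʳ x)
  linCombL-scale x (a ∷ as) []      S = ≈-sym (zeroʳ x)
  linCombL-scale x (a ∷ as) (g ∷ G) S =
    ≈-trans (+-cong (*-assoc x a (g S)) (linCombL-scale x as G S)) (≈-sym (distribˡ _ _ _))

  SpanList-isSubspace : ∀ G → IsSubspace (SpanList G)
  SpanList-isSubspace G = record
    { ≐-closed  = λ { u≐v (as , u≐as) → as , ≐-trans (≐-sym u≐v) u≐as }
    ; zeroF∈    = [] , ≐-refl
    ; +F-closed = λ { (as , u≐as) (bs , v≐bs) →
                      addCoeffs as bs , ≐-trans (+F-cong u≐as v≐bs) (≐-sym (linCombL-add as bs G)) }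
    ; ·F-closed = λ { x (as , u≐as) →
                      map (x *_) as , ≐-trans (λ S → *-congˡ (u≐as S)) (≐-sym (linCombL-scale x as G)) } }

  SpanList-least : ∀ {L G} → IsSubspace L → All L G → ∀ {v} → SpanList G v → L v
  SpanList-least {L} L-sub G⊆L (as , v≐as) = ≐-closed L-sub (≐-sym v≐as) (combine as _ G⊆L)
    where
    combine : ∀ as G → All L G → L (linCombL as G)
    combine []       G       _          = zeroF∈ L-sub
    combine (a ∷ as) []      _          = zeroF∈ L-sub
    combine (a ∷ as) (g ∷ G) (g∈L ∷ G⊆L) = +F-closed L-sub (·F-closed L-sub a g∈L) (combine as G G⊆L)

  SpanList-generators : ∀ G → All (SpanList G) G
  SpanList-generators []      = []
  SpanList-generators (g ∷ G) =
    (1# ∷ [] , λ S → ≈-sym (≈-trans (+-identityʳ _) (*-identityˡ _)))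
    ∷ All.map (λ { (as , v≐as) → 0# ∷ as , λ S →
                     ≈-trans (v≐as S) (≈-sym (≈-trans (+-congʳ (zeroˡ _)) (+-identityˡ _))) })
              (SpanList-generators G)

  SpanList-map : ∀ {f} → IsLinear f → ∀ G {v} → SpanList G v → SpanList (map f G) (f v)
  SpanList-map {f} f-lin G (as , v≐as) = as , ≐-trans (≐-resp f-lin v≐as) (f-linCombL as G)
    where
    f-linCombL : ∀ as G → f (linCombL as G) ≐ linCombL as (map f G)
    f-linCombL []       G       = zeroF-homo f-lin
    f-linCombL (a ∷ as) []      = zeroF-homo f-lin
    f-linCombL (a ∷ as) (g ∷ G) = ≐-trans (+F-homo f-lin _ _) (+F-cong (·F-homo f-lin a g) (f-linCombL as G))

  SpanList-++ˡ : ∀ G H {v} → SpanList G v → SpanList (G ++ H) v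
  SpanList-++ˡ G H (as , v≐as) = proj₁ (pad as G) , ≐-trans v≐as (proj₂ (pad as G))
    where
    pad : ∀ as G → Σ (List Carrier) λ bs → linCombL as G ≐ linCombL bs (G ++ H)
    pad []       G       = [] , ≐-refl
    pad (a ∷ as) []      = [] , ≐-refl
    pad (a ∷ as) (g ∷ G) = a ∷ proj₁ (pad as G) , +F-cong ≐-refl (proj₂ (pad as G))

  SpanList-++ʳ : ∀ G H {v} → SpanList H v → SpanList (G ++ H) v
  SpanList-++ʳ []      H v∈H = v∈H
  SpanList-++ʳ (g ∷ G) H v∈H with SpanList-++ʳ G H v∈H
  ... | as , v≐as = 0# ∷ as , λ S → ≈-trans (v≐as S) (≈-sym (≈-trans (+-congʳ (zeroˡ _)) (+-identityˡ _)))

  FinitelyGenerated : Sub → Set (c ⊔ ℓ)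
  FinitelyGenerated L = Σ (List Form) λ G → All L G × (∀ {v} → L v → SpanList G v)

  FinitelyGenerated-resp-≡ₛ : ∀ {L L′} → L ≡ₛ L′ → FinitelyGenerated L → FinitelyGenerated L′
  FinitelyGenerated-resp-≡ₛ L≡L′ (G , G⊆L , L⊆⟨G⟩) =
    G , All.map (proj₁ (L≡L′ _)) G⊆L , λ {v} v∈L′ → L⊆⟨G⟩ (proj₂ (L≡L′ v) v∈L′)

  -- Gaussian elimination, one coordinate S at a time.
  module Kernel {ψ : Form → Form} (ψ-linear : IsLinear ψ) {L : Sub} (L-sub : IsSubspace L) where

    Vanishes : Form → Subset n → Set ℓ
    Vanishes u S = ψ u S ≈ 0#

    SpansVanishing : List (Subset n) → List Form → Set (c ⊔ ℓ)
    SpansVanishing Ss H = All (λ h → L h × All (Vanishes h) Ss) H ×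
                          (∀ {u} → L u → All (Vanishes u) Ss → SpanList H u)

    findPivot : ∀ S {Ss} H → All (λ h → L h × All (Vanishes h) Ss) H →
      DoubleNegation (All (λ h → Vanishes h S) H ⊎ Σ Form λ p → (L p × All (Vanishes p) Ss) × ¬ Vanishes p S)
    findPivot S []      []           = return (inj₁ [])
    findPivot S (h ∷ H) (h∈ ∷ H⊆) = ¬¬-excluded-middle >>= λ
      { (no ψh≉0)  → return (inj₂ (h , h∈ , ψh≉0))
      ; (yes ψh≈0) → findPivot S H H⊆ >>= λ
          { (inj₁ allVanish) → return (inj₁ (ψh≈0 ∷ allVanish))
          ; (inj₂ pivot)     → return (inj₂ pivot) } }

    module Reduce (S : Subset n) {p : Form} (ψp≉0 : ¬ Vanishes p S) where
      c⁻¹ : Carrier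
      c⁻¹ = proj₁ (inverse (ψ p S) ψp≉0)

      coefficient : Form → Carrier
      coefficient h = ψ h S * c⁻¹

      reduce : Form → Form
      reduce h = h -F (coefficient h ·F p)

      reduce-linear : IsLinear reduce
      reduce-linear = +F-linear id-linear (∘-linear negF-linear along-p)
        where
        along-p : IsLinear (λ h → coefficient h ·F p)
        along-p = record
          { ≐-resp  = λ u≐v _ → *-congʳ (*-congʳ (≐-resp ψ-linear u≐v S))
          ; +F-homo = λ u v _ → ≈-trans (*-congʳ (≈-trans (*-congʳ (+F-homo ψ-linear u v S)) (distribʳ _ _ _)))
                                        (distribʳ _ _ _)
          ; ·F-homo = λ a u _ → ≈-trans (*-congʳ (≈-trans (*-congʳ (·F-homo ψ-linear a u S)) (*-assoc _ _ _)))
                                        (*-assoc _ _ _) }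

      ψ-reduce : ∀ h → ψ (reduce h) ≐ (ψ h -F (coefficient h ·F ψ p))
      ψ-reduce h = ≐-trans (-F-homo ψ-linear h _) (+F-cong ≐-refl (negF-cong (·F-homo ψ-linear _ p)))

      p*c⁻¹≈1 : ψ p S * c⁻¹ ≈ 1#
      p*c⁻¹≈1 = proj₂ (inverse (ψ p S) ψp≉0)

      reduce-vanishes : ∀ h → Vanishes (reduce h) S
      reduce-vanishes h = begin
        ψ (reduce h) S                     ≈⟨ ψ-reduce h S ⟩
        ψ h S + - ((ψ h S * c⁻¹) * ψ p S)  ≈⟨ +-congˡ (-‿cong (*-assoc _ _ _)) ⟩
        ψ h S + - (ψ h S * (c⁻¹ * ψ p S))  ≈⟨ +-congˡ (-‿cong (*-congˡ (≈-trans (*-comm _ _) p*c⁻¹≈1))) ⟩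
        ψ h S + - (ψ h S * 1#)             ≈⟨ +-congˡ (-‿cong (*-identityʳ _)) ⟩
        ψ h S + - ψ h S                    ≈⟨ -‿inverseʳ _ ⟩
        0#                                 ∎
        where open SetoidReasoning setoid

      reduce-keeps-vanishing : ∀ {h S′} → Vanishes h S′ → Vanishes p S′ → Vanishes (reduce h) S′
      reduce-keeps-vanishing {h} {S′} ψh≈0 ψp≈0 = begin
        ψ (reduce h) S′                      ≈⟨ ψ-reduce h S′ ⟩
        ψ h S′ + - (coefficient h * ψ p S′)  ≈⟨ +-cong ψh≈0 (-‿cong (≈-trans (*-congˡ ψp≈0) (zeroʳ _))) ⟩
        0# + - 0#                            ≈⟨ +-identityˡ _ ⟩
        - 0#                                 ≈⟨ -0#≈0# ⟩
        0#                                   ∎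
        where open SetoidReasoning setoid

      reduce-fixes : ∀ {u} → Vanishes u S → reduce u ≐ u
      reduce-fixes {u} ψu≈0 S′ = begin
        u S′ + - ((ψ u S * c⁻¹) * p S′)  ≈⟨ +-congˡ (-‿cong (*-congʳ (≈-trans (*-congʳ ψu≈0) (zeroˡ _)))) ⟩
        u S′ + - (0# * p S′)             ≈⟨ +-congˡ (≈-trans (-‿cong (zeroˡ _)) -0#≈0#) ⟩
        u S′ + 0#                        ≈⟨ +-identityʳ _ ⟩
        u S′                             ∎
        where open SetoidReasoning setoid

    eliminate-pivot : ∀ S {Ss H p} (ψp≉0 : ¬ Vanishes p S) → L p → All (Vanishes p) Ss →
                      SpansVanishing Ss H → SpansVanishing (S ∷ Ss) (map (Reduce.reduce S ψp≉0) H)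
    eliminate-pivot S {Ss} {H} {p} ψp≉0 p∈L p-vanishes (H⊆ , H-spans) =
      All.map⁺ (All.map reduced H⊆) , spans
      where
      open Reduce S ψp≉0
      reduced : ∀ {h} → L h × All (Vanishes h) Ss → L (reduce h) × All (Vanishes (reduce h)) (S ∷ Ss)
      reduced {h} (h∈L , h-vanishes) =
        -F-closed L-sub h∈L (·F-closed L-sub _ p∈L) ,
        reduce-vanishes h ∷ All.zipWith (λ (ψh≈0 , ψp≈0) → reduce-keeps-vanishing ψh≈0 ψp≈0) (h-vanishes , p-vanishes)
      spans : ∀ {u} → L u → All (Vanishes u) (S ∷ Ss) → SpanList (map reduce H) u
      spans u∈L (ψu≈0 ∷ u-vanishes) with SpanList-map reduce-linear H (H-spans u∈L u-vanishes)
      ... | as , reduce-u≐as = as , ≐-trans (≐-sym (reduce-fixes ψu≈0)) reduce-u≐as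

    eliminate : ∀ S {Ss H} → SpansVanishing Ss H → DoubleNegation (Σ (List Form) (SpansVanishing (S ∷ Ss)))
    eliminate S {Ss} {H} (H⊆ , H-spans) = findPivot S H H⊆ >>= λ
      { (inj₁ allVanish) → return (H , All.zipWith (λ ((h∈L , zs) , z) → h∈L , z ∷ zs) (H⊆ , allVanish) ,
                                    λ { {u} u∈L (_ ∷ u-vanishes) → H-spans u∈L u-vanishes })
      ; (inj₂ (p , (p∈L , p-vanishes) , ψp≉0)) →
          return (_ , eliminate-pivot S ψp≉0 p∈L p-vanishes (H⊆ , H-spans)) }

    spansVanishing : FinitelyGenerated L → ∀ Ss → DoubleNegation (Σ (List Form) (SpansVanishing Ss))
    spansVanishing (G , G⊆L , L⊆⟨G⟩) []       = return (G , All.map (_, []) G⊆L , λ {u} u∈L _ → L⊆⟨G⟩ u∈L)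
    spansVanishing L-fg                (S ∷ Ss) = spansVanishing L-fg Ss >>= λ (H , inv) → eliminate S inv

    kernel-finitelyGenerated : FinitelyGenerated L → DoubleNegation (FinitelyGenerated (λ u → L u × ψ u ≐ zeroF))
    kernel-finitelyGenerated L-fg = spansVanishing L-fg (allSubsets n) >>= λ (K , K⊆ , K-spans) →
      return (K , All.map (λ (k∈L , k-vanishes) → k∈L , λ S → All.lookup k-vanishes (∈-allSubsets S)) K⊆ ,
              λ {u} (u∈L , ψu≐0) → K-spans u∈L (All.universal ψu≐0 (allSubsets n)))

module Shifting {c ℓ} (F : Field c ℓ) (n : ℕ) where
  open Field F renaming (refl to ≈-refl; sym to ≈-sym; trans to ≈-trans)
  open Exterior F n
  open Forms F n
  open Subspaces F n

  Generators : Fin n → Fin n → Sub → Sub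
  Generators i j L r = ∃ λ m → L m × ¬ (m ≐ zeroF) × NRel i j m r

  PartXClosed : Fin n → Sub → Set (c ⊔ ℓ)
  PartXClosed j L = ∀ {v} → L v → L (partX j v)

  TransferClosed : Fin n → Fin n → Sub → Set (c ⊔ ℓ)
  TransferClosed j i L = ∀ {v} → L v → L (transfer j i v)

  PartXClosed-resp-≡ₛ : ∀ {j L L′} → L ≡ₛ L′ → PartXClosed j L → PartXClosed j L′
  PartXClosed-resp-≡ₛ L≡L′ X-closed v∈L′ = proj₁ (L≡L′ _) (X-closed (proj₂ (L≡L′ _) v∈L′))

  NSub-resp-≡ₛ : ∀ i j {L L′} → L ≡ₛ L′ → NSub i j L ≡ₛ NSub i j L′
  NSub-resp-≡ₛ i j L≡L′ v = transport L≡L′ , transport (≡ₛ-sym L≡L′)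
    where
    transport : ∀ {L L′} → L ≡ₛ L′ → NSub i j L v → NSub i j L′ v
    transport {L} {L′} L≡L′ (cs , gens , v≐cs) = cs , go gens , v≐cs
      where
      go : ∀ {cs} → AllSnd (Generators i j L) cs → AllSnd (Generators i j L′) cs
      go []                                  = []
      go ((m , m∈L , m≉0 , rel) ∷ gens) = (m , proj₁ (L≡L′ m) m∈L , m≉0 , rel) ∷ go gens

  Stable : Fin n → Fin n → Sub → Set (c ⊔ ℓ)
  Stable i j L = NSub i j L ≡ₛ L

  Stable-resp-≡ₛ : ∀ i j {L L′} → L ≡ₛ L′ → Stable i j L → Stable i j L′
  Stable-resp-≡ₛ i j L≡L′ stable = ≡ₛ-trans (NSub-resp-≡ₛ i j (≡ₛ-sym L≡L′)) (≡ₛ-trans stable L≡L′)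

  module Shift (i j : Fin n) (i≢j : i ≢ j) {L : Sub} (L-sub : IsSubspace L) where

    N : Sub
    N = NSub i j L

    N-isSubspace : IsSubspace N
    N-isSubspace = Span-isSubspace (Generators i j L)

    NSub-map-into : ∀ {f M} → IsLinear f → IsSubspace M →
      (∀ {m} → L m → ¬ (shift j i m ≐ zeroF) → M (f (shift j i m))) →
      (∀ {m} → L m → shift j i m ≐ zeroF → M (f (ePart j m))) →
      ∀ {v} → N v → M (f v)
    NSub-map-into {f} {M} f-lin M-sub on-shift on-ePart = Span-least (preimage-isSubspace f-lin M-sub) on-generator
      where
      on-generator : ∀ {r} → Generators i j L r → M (f r)
      on-generator (m , m∈L , _ , inj₁ (shift≉0 , r≐shift)) =
        ≐-closed M-sub (≐-resp f-lin (≐-sym r≐shift)) (on-shift m∈L shift≉0)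
      on-generator (m , m∈L , _ , inj₂ (shift≈0 , r≐ePart)) =
        ≐-closed M-sub (≐-resp f-lin (≐-sym r≐ePart)) (on-ePart m∈L shift≈0)

    shift-generator : ∀ {m} → L m → ¬ (shift j i m ≐ zeroF) → N (shift j i m)
    shift-generator m∈L shift≉0 =
      Span-generator (_ , m∈L , shift≉0 ∘ ≐zeroF⇒≐zeroF (shift-linear j i) , inj₁ (shift≉0 , ≐-refl))

    ePart-generator : ∀ {m} → L m → shift j i m ≐ zeroF → ¬ (ePart j m ≐ zeroF) → N (ePart j m)
    ePart-generator m∈L shift≈0 ePart≉0 =
      Span-generator (_ , m∈L , ePart≉0 ∘ ≐zeroF⇒≐zeroF (ePart-linear j) , inj₂ (shift≈0 , ≐-refl))

    zero-or-∈N : ∀ {u} → (¬ (u ≐ zeroF) → N u) → DoubleNegation (N u)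
    zero-or-∈N {u} ∈N = ¬¬-excluded-middle {A = u ≐ zeroF} >>= λ
      { (yes u≈0) → return (≐-closed N-isSubspace (≐-sym u≈0) (zeroF∈ N-isSubspace))
      ; (no u≉0)  → return (∈N u≉0) }

    stable⇒partX-closed : Stable i j L → PartXClosed j L
    stable⇒partX-closed N≡L v∈L = NSub-map-into (partX-linear j) L-sub
      (λ {m} m∈L shift≉0 → ≐-closed L-sub (≐-sym (partX-shift i≢j m)) (proj₁ (N≡L _) (shift-generator m∈L shift≉0)))
      (λ {m} _ _ → ≐-closed L-sub (≐-sym (partX-wedge j (partY j m))) (zeroF∈ L-sub))
      (proj₂ (N≡L _) v∈L)

    stable⇒transfer-closed : Stable i j L → TransferClosed j i L
    stable⇒transfer-closed N≡L v∈L = NSub-map-into (transfer-linear j i) L-sub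
      (λ {m} _ _ → ≐-closed L-sub (≐-sym (transfer-shift i i≢j m)) (zeroF∈ L-sub))
      (λ {m} m∈L shift≈0 → ≐-closed L-sub
         (≐-sym (≐-trans (transfer-ePart j i m) (shift≐0⇒transfer≐-partX j i m shift≈0)))
         (negF-closed L-sub (stable⇒partX-closed N≡L m∈L)))
      (proj₂ (N≡L _) v∈L)

    module Closed (X-closed : PartXClosed j L) (T-closed : TransferClosed j i L) where

      ePart∈L : ∀ {m} → L m → L (ePart j m)
      ePart∈L {m} m∈L = ≐-closed L-sub (≐-sym (ePart≐-partX j m)) (-F-closed L-sub m∈L (X-closed m∈L))

      N⊆L : ∀ {v} → N v → L v
      N⊆L = NSub-map-into id-linear L-sub (λ m∈L _ → +F-closed L-sub (X-closed m∈L) (T-closed m∈L))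
                                           (λ m∈L _ → ePart∈L m∈L)

      partX∈N : ∀ {g} → L g → DoubleNegation (N (partX j g))
      partX∈N {g} g∈L = zero-or-∈N λ Xg≉0 →
        ≐-closed N-isSubspace (shift-partX j i g)
          (shift-generator (X-closed g∈L) (λ shift≈0 → Xg≉0 (≐-trans (≐-sym (shift-partX j i g)) shift≈0)))

      -- ePart j g is N_{j→i} of ePart j g - transfer j i g, whose shift vanishes.
      ePart∈N : ∀ {g} → L g → DoubleNegation (N (ePart j g))
      ePart∈N {g} g∈L = zero-or-∈N λ Eg≉0 →
        ≐-closed N-isSubspace (ePart-ePart-transfer i≢j g)
          (ePart-generator (-F-closed L-sub (ePart∈L g∈L) (T-closed g∈L)) (shift-ePart-transfer i≢j g)
                           (Eg≉0 ∘ ≐-trans (≐-sym (ePart-ePart-transfer i≢j g))))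

      ∈N : ∀ {g} → L g → DoubleNegation (N g)
      ∈N {g} g∈L = ePart∈N g∈L >>= λ Eg∈N → partX∈N g∈L >>= λ Xg∈N →
        return (≐-closed N-isSubspace (ePart+partX j g) (+F-closed N-isSubspace Eg∈N Xg∈N))

    closed⇒stable : PartXClosed j L → TransferClosed j i L → FinitelyGenerated L → DoubleNegation (Stable i j L)
    closed⇒stable X-closed T-closed (G , G⊆L , L⊆⟨G⟩) = ¬¬-All (All.map ∈N G⊆L) >>= λ G⊆N →
      return λ v → N⊆L , λ v∈L → SpanList-least N-isSubspace G⊆N (L⊆⟨G⟩ v∈L)
      where open Closed X-closed T-closed

    record ShiftFacts : Set (c ⊔ ℓ) where
      field
        shift∈N : ∀ {u} → L u → N (shift j i u)
        ePart∈N : ∀ {u} → L u → shift j i u ≐ zeroF → N (ePart j u)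
        N-finitelyGenerated : FinitelyGenerated N

    shiftFacts : FinitelyGenerated L → DoubleNegation ShiftFacts
    shiftFacts L-fg@(G , G⊆L , L⊆⟨G⟩) =
      Kernel.kernel-finitelyGenerated (shift-linear j i) L-sub L-fg >>= λ (K , K⊆ , K-spans) →
      ¬¬-All (All.map⁺ (All.map shift∈N G⊆L)) >>= λ shiftG⊆N →
      ¬¬-All (All.map⁺ (All.map ePart∈N K⊆)) >>= λ ePartK⊆N →
      return (record
        { shift∈N = λ u∈L → SpanList-least N-isSubspace shiftG⊆N (SpanList-map (shift-linear j i) G (L⊆⟨G⟩ u∈L))
        ; ePart∈N = λ u∈L shift≈0 →
            SpanList-least N-isSubspace ePartK⊆N (SpanList-map (ePart-linear j) K (K-spans (u∈L , shift≈0)))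
        ; N-finitelyGenerated =
            map (shift j i) G ++ map (ePart j) K , All.++⁺ shiftG⊆N ePartK⊆N ,
            NSub-map-into id-linear (SpanList-isSubspace _)
              (λ m∈L _ → SpanList-++ˡ _ _ (SpanList-map (shift-linear j i) G (L⊆⟨G⟩ m∈L)))
              (λ m∈L shift≈0 → SpanList-++ʳ _ _ (SpanList-map (ePart-linear j) K (K-spans (m∈L , shift≈0)))) })
      where
      shift∈N : ∀ {g} → L g → DoubleNegation (N (shift j i g))
      shift∈N g∈L = zero-or-∈N (shift-generator g∈L)
      ePart∈N : ∀ {k} → L k × shift j i k ≐ zeroF → DoubleNegation (N (ePart j k))
      ePart∈N (k∈L , shift≈0) = zero-or-∈N (ePart-generator k∈L shift≈0)

    module AfterShift (facts : ShiftFacts) where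
      open ShiftFacts facts

      N-partX-closed : PartXClosed j N
      N-partX-closed = NSub-map-into (partX-linear j) N-isSubspace
        (λ {m} m∈L _ → ≐-closed N-isSubspace (≐-sym (partX-shift i≢j m)) (shift∈N m∈L))
        (λ {m} _ _ → ≐-closed N-isSubspace (≐-sym (partX-wedge j (partY j m))) (zeroF∈ N-isSubspace))

      commuting-closed⇒N-closed : ∀ {g} → IsLinear g → (∀ {v} → L v → L (g v)) →
        (∀ m → g (shift j i m) ≐ shift j i (g m)) → (∀ m → g (ePart j m) ≐ ePart j (g m)) →
        ∀ {v} → N v → N (g v)
      commuting-closed⇒N-closed g-lin g-closed shift-comm ePart-comm = NSub-map-into g-lin N-isSubspace
        (λ {m} m∈L _ → ≐-closed N-isSubspace (≐-sym (shift-comm m)) (shift∈N (g-closed m∈L)))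
        (λ {m} m∈L shift≈0 → ≐-closed N-isSubspace (≐-sym (ePart-comm m))
           (ePart∈N (g-closed m∈L) (≐-trans (≐-sym (shift-comm m)) (≐zeroF⇒≐zeroF g-lin shift≈0))))

      partX-closed-preserved : ∀ {k} → k ≢ i → k ≢ j → PartXClosed k L → PartXClosed k N
      partX-closed-preserved {k} k≢i k≢j X-closed =
        commuting-closed⇒N-closed (partX-linear k) X-closed (partX-shift-comm k≢i k≢j) (partX-transfer-comm k≢j k≢j)

      transfer-closed-preserved : ∀ {j′ i′} → j ≢ i′ → j ≢ j′ → i ≢ i′ → i ≢ j′ →
                                  TransferClosed j′ i′ L → TransferClosed j′ i′ N
      transfer-closed-preserved {j′} {i′} j≢i′ j≢j′ i≢i′ i≢j′ T-closed =
        commuting-closed⇒N-closed (transfer-linear j′ i′) T-closed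
          (transfer-shift-comm j≢i′ j≢j′ i≢i′ i≢j′) (transfer-ePart-comm j≢i′ j≢j′)

      transfer-closed-preserved-sameTarget : ∀ {j′} → j ≢ j′ → j′ ≢ i →
                                             TransferClosed j′ i L → TransferClosed j′ i N
      transfer-closed-preserved-sameTarget {j′} j≢j′ j′≢i T-closed =
        commuting-closed⇒N-closed (transfer-linear j′ i) T-closed
          (transfer-shift-comm-sameTarget (i≢j ∘ sym) j≢j′ j′≢i) (transfer-ePart-comm (i≢j ∘ sym) j≢j′)

      transfer-closed-preserved-sameSource : ∀ {i′} → i′ ≢ j → TransferClosed j i′ L → TransferClosed j i′ N
      transfer-closed-preserved-sameSource {i′} i′≢j T-closed = NSub-map-into (transfer-linear j i′) N-isSubspace
        (λ {m} _ _ → ≐-closed N-isSubspace (≐-sym (transfer-shift i′ i≢j m)) (zeroF∈ N-isSubspace))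
        (λ {m} m∈L _ → ≐-closed N-isSubspace
           (≐-sym (≐-trans (transfer-ePart j i′ m) (≐-sym (shift-fixes j i (partX-transfer i′≢j m)))))
           (shift∈N (T-closed m∈L)))

      transfer-closed-preserved-intoSource : ∀ {j′} → j′ ≢ j → j′ ≢ i →
        TransferClosed j′ j L → TransferClosed j′ i L → TransferClosed j′ j N
      transfer-closed-preserved-intoSource {j′} j′≢j j′≢i Tj-closed Ti-closed =
        NSub-map-into (transfer-linear j′ j) N-isSubspace
        (λ {m} m∈L _ → ≐-closed N-isSubspace (ePart-transfer-difference (i≢j ∘ sym) j′≢j j′≢i m)
           (ePart∈N (-F-closed L-sub (Tj-closed m∈L) (Ti-closed m∈L)) (shift-transfer-difference j′ (i≢j ∘ sym) m)))
        (λ {m} _ _ → ≐-closed N-isSubspace (≐-sym (wedge-partY-wedge j′≢j (partY j m))) (zeroF∈ N-isSubspace))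

      partX-closed⇒N-transfer-closed : PartXClosed j L → TransferClosed j i N
      partX-closed⇒N-transfer-closed X-closed = NSub-map-into (transfer-linear j i) N-isSubspace
        (λ {m} _ _ → ≐-closed N-isSubspace (≐-sym (transfer-shift i i≢j m)) (zeroF∈ N-isSubspace))
        (λ {m} m∈L shift≈0 → ≐-closed N-isSubspace
           (≐-sym (≐-trans (transfer-ePart j i m) (shift≐0⇒transfer≐-partX j i m shift≈0)))
           (negF-closed N-isSubspace (≐-closed N-isSubspace (shift-partX j i m) (shift∈N (X-closed m∈L)))))

open import Data.Nat using (_+_; _∸_; _≤_; _<_; z≤n; s≤s)
open import Data.Nat.Properties
  using (module ≤-Reasoning; ≤-refl; ≤-antisym; ≤-trans; ≤-reflexive; <-≤-trans; <⇒≤; <⇒≢; ≤∧≢⇒<; <-irrefl; <-cmp;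
         +-comm; +-suc; +-mono-≤; +-monoˡ-≤; +-monoʳ-≤; +-monoʳ-<; m≤m+n; n≤1+n)

∣[]≔inside∣≤1+∣∣ : ∀ {k} (p : Subset k) x → ∣ p [ x ]≔ inside ∣ ≤ suc ∣ p ∣
∣[]≔inside∣≤1+∣∣ (true  ∷ p) Fin.zero    = n≤1+n _
∣[]≔inside∣≤1+∣∣ (false ∷ p) Fin.zero    = ≤-refl
∣[]≔inside∣≤1+∣∣ (true  ∷ p) (Fin.suc x) = s≤s (∣[]≔inside∣≤1+∣∣ p x)
∣[]≔inside∣≤1+∣∣ (false ∷ p) (Fin.suc x) = ∣[]≔inside∣≤1+∣∣ p x

module Rank {n : ℕ} (I : Subset n) where

  rank : Fin n → ℕ
  rank x = ∣ below I x ∣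

  ∈-below⁺ : ∀ {s x} → s ∈ I → s Fin.< x → s ∈ below I x
  ∈-below⁺ {s} {x} s∈I s<x = lookup⇒[]= s (below I x)
    (trans (lookup∘tabulate _ s) (cong₂ _∧_ ([]=⇒lookup s∈I) (<⇒≺ᵇ s<x)))

  ∈-below⁻ : ∀ {s x} → s ∈ below I x → s ∈ I × s Fin.< x
  ∈-below⁻ {s} {x} s∈below with ∧≡true⁻ (trans (sym (lookup∘tabulate _ s)) ([]=⇒lookup s∈below))
  ... | Is , s≺x = lookup⇒[]= s I Is , ≺ᵇ⇒< s≺x

  rank-mono : ∀ {x y} → toℕ x ≤ toℕ y → rank x ≤ rank y
  rank-mono x≤y = p⊆q⇒∣p∣≤∣q∣ λ s∈ →
    let (s∈I , s<x) = ∈-below⁻ s∈ in ∈-below⁺ s∈I (<-≤-trans s<x x≤y)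

  rank-strict : ∀ {x y} → x ∈ I → x Fin.< y → rank x < rank y
  rank-strict {x} x∈I x<y = p⊂q⇒∣p∣<∣q∣
    ( (λ s∈ → let (s∈I , s<x) = ∈-below⁻ s∈ in ∈-below⁺ s∈I (Fin.<-trans s<x x<y))
    , x , ∈-below⁺ x∈I x<y , λ x∈ → <-irrefl refl (proj₂ (∈-below⁻ x∈)) )

  rank<∣I∣ : ∀ {x} → x ∈ I → rank x < ∣ I ∣
  rank<∣I∣ {x} x∈I = p⊂q⇒∣p∣<∣q∣
    ((λ s∈ → proj₁ (∈-below⁻ {x = x} s∈)) , x , x∈I , λ x∈ → <-irrefl refl (proj₂ (∈-below⁻ x∈)))

  rank-reflects-< : ∀ {x y} → rank x < rank y → x Fin.< y
  rank-reflects-< {x} {y} rx<ry with Fin.<-cmp x y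
  ... | tri< x<y _ _ = x<y
  ... | tri≈ _ refl _ = ⊥-elim (<-irrefl refl rx<ry)
  ... | tri> _ _ y<x = ⊥-elim (<-irrefl refl (<-≤-trans rx<ry (rank-mono (<⇒≤ y<x))))

  rank-injective : ∀ {x y} → x ∈ I → y ∈ I → rank x ≡ rank y → x ≡ y
  rank-injective {x} {y} x∈I y∈I rx≡ry with Fin.<-cmp x y
  ... | tri< x<y _ _ = ⊥-elim (<-irrefl rx≡ry (rank-strict x∈I x<y))
  ... | tri≈ _ x≡y _ = x≡y
  ... | tri> _ _ y<x = ⊥-elim (<-irrefl (sym rx≡ry) (rank-strict y∈I y<x))

  rank-gap : ∀ {i j} → i ∈ I → (∀ {h} → h ∈ I → i Fin.< h → h Fin.< j → ⊥) → rank j ≤ suc (rank i)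
  rank-gap {i} {j} i∈I gap = ≤-trans (p⊆q⇒∣p∣≤∣q∣ below-j⊆) (∣[]≔inside∣≤1+∣∣ (below I i) i)
    where
    below-j⊆ : below I j ⊆ below I i [ i ]≔ inside
    below-j⊆ {s} s∈ with ∈-below⁻ s∈ | s Fin.≟ i
    ... | _ | yes refl = []≔-updates (below I i) i
    ... | s∈I , s<j | no s≢i with Fin.<-cmp s i
    ...   | tri< s<i _ _ = []≔-minimal (below I i) s i s≢i (∈-below⁺ s∈I s<i)
    ...   | tri≈ _ s≡i _ = ⊥-elim (s≢i s≡i)
    ...   | tri> _ _ i<s = ⊥-elim (gap s∈I i<s s<j)

slots : ℕ → ℕ
slots zero    = 0
slots (suc t) = suc (suc (t + slots t))

-- The pairs b < a, listed lexicographically, each adjacent pair (b + 1 = a) taking two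
-- consecutive slots: slots t is the number of slots used by the pairs with a ≤ t, and
-- slot (a , b) is the (upper) slot of the pair (a , b).
slot : ℕ × ℕ → ℕ
slot (zero  , b) = 0
slot (suc a , b) with b ℕ.≟ a
... | yes _ = suc (slots a + b)
... | no  _ = slots a + b

slots-mono : ∀ {t t′} → t ≤ t′ → slots t ≤ slots t′
slots-mono {zero}  _         = z≤n
slots-mono {suc t} (s≤s t≤t′) = s≤s (s≤s (+-mono-≤ t≤t′ (slots-mono t≤t′)))

slots≡ : ∀ t → slots t ≡ t + suc t C 2
slots≡ zero    = sym (k>n⇒nCk≡0 {1} {2} (s≤s (s≤s z≤n)))
slots≡ (suc t) = begin
  suc (suc (t + slots t))             ≡⟨ cong (λ z → suc (suc (t + z))) (slots≡ t) ⟩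
  suc (suc (t + (t + suc t C 2)))     ≡⟨ cong suc (sym (+-suc t (t + suc t C 2))) ⟩
  suc (t + suc (t + suc t C 2))       ≡⟨ cong (λ z → suc (t + (z + suc t C 2))) (sym (nC1≡n (suc t))) ⟩
  suc (t + (suc t C 1 + suc t C 2))   ≡⟨ cong (λ z → suc (t + z)) (nCk+nC[k+1]≡[n+1]C[k+1] (suc t) 1) ⟩
  suc t + suc (suc t) C 2             ∎
  where open ≡-Reasoning

slot-<-diagonal : ∀ {a b} → b < a → slot (suc a , b) ≡ slots a + b
slot-<-diagonal {a} {b} b<a with b ℕ.≟ a
... | yes b≡a = ⊥-elim (<⇒≢ b<a b≡a)
... | no  _   = refl

slot-diagonal : ∀ a → slot (suc a , a) ≡ suc (slots a + a)
slot-diagonal a with a ℕ.≟ a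
... | yes _   = refl
... | no  a≢a = ⊥-elim (a≢a refl)

slots+b≤slot : ∀ a b → slots a + b ≤ slot (suc a , b)
slots+b≤slot a b with b ℕ.≟ a
... | yes _ = n≤1+n _
... | no  _ = ≤-refl

slot<slots : ∀ {a b} → b ≤ a → slot (suc a , b) < slots (suc a)
slot<slots {a} {b} b≤a with b ℕ.≟ a
... | yes refl = s≤s (s≤s (≤-reflexive (+-comm (slots a) a)))
... | no  b≢a  = s≤s (begin
  slots a + b        ≡⟨ +-comm (slots a) b ⟩
  b + slots a        ≤⟨ n≤1+n _ ⟩
  suc b + slots a    ≤⟨ +-monoˡ-≤ (slots a) (≤∧≢⇒< b≤a b≢a) ⟩
  a + slots a        ≤⟨ n≤1+n _ ⟩
  suc (a + slots a)  ∎)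
  where open ≤-Reasoning

infix 4 _<ₗₑₓ_
_<ₗₑₓ_ : ℕ × ℕ → ℕ × ℕ → Set
_<ₗₑₓ_ = ×-Lex _≡_ _<_ _<_

Adjacent : ℕ × ℕ → Set
Adjacent (a , b) = suc b ≡ a

slot-<ₗₑₓ : ∀ {a b a′ b′} → b < a → b′ < a′ → (a′ , b′) <ₗₑₓ (a , b) → slot (a′ , b′) < slot (a , b)
slot-<ₗₑₓ {suc a} {b} {suc a′} {b′} _ (s≤s b′≤a′) (inj₁ (s≤s a′<a)) = begin-strict
  slot (suc a′ , b′)  <⟨ slot<slots b′≤a′ ⟩
  slots (suc a′)      ≤⟨ slots-mono a′<a ⟩
  slots a             ≤⟨ m≤m+n (slots a) b ⟩
  slots a + b         ≤⟨ slots+b≤slot a b ⟩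
  slot (suc a , b)    ∎
  where open ≤-Reasoning
slot-<ₗₑₓ {suc a} {b} {_} {b′} (s≤s b≤a) _ (inj₂ (refl , b′<b)) = begin-strict
  slot (suc a , b′)   ≡⟨ slot-<-diagonal (<-≤-trans b′<b b≤a) ⟩
  slots a + b′        <⟨ +-monoʳ-< (slots a) b′<b ⟩
  slots a + b         ≤⟨ slots+b≤slot a b ⟩
  slot (suc a , b)    ∎
  where open ≤-Reasoning

slot-<ₗₑₓ-adjacent : ∀ {a b a′ b′} → Adjacent (a , b) → b′ < a′ → (a′ , b′) <ₗₑₓ (a , b) →
                     suc (slot (a′ , b′)) < slot (a , b)
slot-<ₗₑₓ-adjacent {_} {b} {suc a′} {b′} refl (s≤s b′≤a′) (inj₁ (s≤s a′<a)) = begin-strict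
  suc (slot (suc a′ , b′))  <⟨ s≤s (slot<slots b′≤a′) ⟩
  suc (slots (suc a′))      ≤⟨ s≤s (slots-mono a′<a) ⟩
  suc (slots b)             ≤⟨ s≤s (m≤m+n (slots b) b) ⟩
  suc (slots b + b)         ≡⟨ slot-diagonal b ⟨
  slot (suc b , b)          ∎
  where open ≤-Reasoning
slot-<ₗₑₓ-adjacent {_} {b} {_} {b′} refl _ (inj₂ (refl , b′<b)) = begin-strict
  suc (slot (suc b , b′))  ≡⟨ cong suc (slot-<-diagonal b′<b) ⟩
  suc (slots b + b′)       ≡⟨ +-suc (slots b) b′ ⟨
  slots b + suc b′         <⟨ s≤s (+-monoʳ-≤ (slots b) b′<b) ⟩
  suc (slots b + b)        ≡⟨ slot-diagonal b ⟨
  slot (suc b , b)         ∎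
  where open ≤-Reasoning

slot-adjacent-pos : ∀ {p} → Adjacent p → 0 < slot p
slot-adjacent-pos {_ , b} refl rewrite slot-diagonal b = s≤s z≤n

slot<bound : ∀ {a b N} → b < a → a < N → slot (a , b) < (N ∸ 1) + N C 2
slot<bound {suc a} {b} {suc N} (s≤s b≤a) (s≤s a<N) = begin-strict
  slot (suc a , b)        <⟨ slot<slots b≤a ⟩
  slots (suc a)           ≤⟨ slots-mono a<N ⟩
  slots N                 ≡⟨ slots≡ N ⟩
  N + suc N C 2           ∎
  where open ≤-Reasoning

module PairRun (N m : ℕ) (pair : ∀ s → s < m → ℕ × ℕ)
  (ordered         : ∀ s h → proj₂ (pair s h) < proj₁ (pair s h))
  (bounded         : ∀ s h → proj₁ (pair s h) < N)
  (no-increase     : ∀ s h h′ → ¬ (pair s h <ₗₑₓ pair (suc s) h′))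
  (repeat⇒adjacent : ∀ s h h′ → pair (suc s) h′ ≡ pair s h → Adjacent (pair s h))
  (no-triple       : ∀ s h h′ h″ → pair (suc s) h′ ≡ pair s h → pair (suc (suc s)) h″ ≡ pair (suc s) h′ → ⊥)
  where

  next-≡-or-<ₗₑₓ : ∀ s h h′ → pair (suc s) h′ ≡ pair s h ⊎ pair (suc s) h′ <ₗₑₓ pair s h
  next-≡-or-<ₗₑₓ s h h′ with ×-compare sym <-cmp <-cmp (pair (suc s) h′) (pair s h)
  ... | tri< next<  _ _      = inj₂ next<
  ... | tri≈ _ (e₁ , e₂) _   = inj₁ (cong₂ _,_ e₁ e₂)
  ... | tri> _ _ next>       = ⊥-elim (no-increase s h h′ next>)

  index-before : ∀ s d → s + d < m → s < m
  index-before s d s+d<m = ≤-trans (s≤s (m≤m+n s d)) s+d<m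

  later : ∀ s d → s + suc d < m → suc s + d < m
  later s d = subst (_< m) (+-suc s d)

  -- Each step either moves to a lexicographically smaller pair, or repeats an adjacent pair
  -- once and then moves down.
  steps-after : ∀ d s (h : s < m) → s + d < m → d ≤ slot (pair s h)
  after-step : ∀ d s h h₁ → suc s + d < m →
    pair (suc s) h₁ ≡ pair s h ⊎ pair (suc s) h₁ <ₗₑₓ pair s h → suc d ≤ slot (pair s h)
  after-repeat : ∀ d s h h₁ h₂ → pair (suc s) h₁ ≡ pair s h → suc (suc s) + d < m →
    pair (suc (suc s)) h₂ ≡ pair (suc s) h₁ ⊎ pair (suc (suc s)) h₂ <ₗₑₓ pair (suc s) h₁ →
    suc (suc d) ≤ slot (pair s h)

  steps-after zero    s h _     = z≤n
  steps-after (suc d) s h s+d<m = after-step d s h h₁ (later s d s+d<m) (next-≡-or-<ₗₑₓ s h h₁)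
    where h₁ = index-before (suc s) d (later s d s+d<m)

  after-step d       s h h₁ rest (inj₂ next<)  =
    ≤-trans (s≤s (steps-after d (suc s) h₁ rest)) (slot-<ₗₑₓ (ordered s h) (ordered (suc s) h₁) next<)
  after-step zero    s h h₁ _    (inj₁ repeat) = slot-adjacent-pos (repeat⇒adjacent s h h₁ repeat)
  after-step (suc d) s h h₁ rest (inj₁ repeat) =
    after-repeat d s h h₁ h₂ repeat (later (suc s) d rest) (next-≡-or-<ₗₑₓ (suc s) h₁ h₂)
    where h₂ = index-before (suc (suc s)) d (later (suc s) d rest)

  after-repeat d s h h₁ h₂ repeat _    (inj₁ repeat′) = ⊥-elim (no-triple s h h₁ h₂ repeat repeat′)
  after-repeat d s h h₁ h₂ repeat rest (inj₂ next<)   =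
    ≤-trans (s≤s (s≤s (steps-after d (suc (suc s)) h₂ rest)))
            (slot-<ₗₑₓ-adjacent (repeat⇒adjacent s h h₁ repeat) (ordered (suc (suc s)) h₂)
                                (subst (pair (suc (suc s)) h₂ <ₗₑₓ_) repeat next<))

  length-bound : m ≤ (N ∸ 1) + N C 2
  length-bound = run-of-length m ≤-refl
    where
    run-of-length : ∀ k → k ≤ m → k ≤ (N ∸ 1) + N C 2
    run-of-length zero    _     = z≤n
    run-of-length (suc d) 1+d≤m = <-≤-trans (s≤s (steps-after d 0 h 1+d≤m)) (slot<bound (ordered 0 h) (bounded 0 h))
      where h = index-before 0 d 1+d≤m

module Procedure {c ℓ} (F : Field c ℓ) (n : ℕ) (I : Subset n) where
  open Exterior F n
  open Forms F n
  open Subspaces F n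
  open Shifting F n

  record StepView (L L′ : Sub) : Set (c ⊔ ℓ) where
    field
      i j       : Fin n
      i<j       : i Fin.< j
      i∈I       : i ∈ I
      j∈I       : j ∈ I
      unstable  : ¬ Stable i j L
      L′≡N      : L′ ≡ₛ NSub i j L
      lastPair  : ∀ i′ j′ → i′ Fin.< j′ → i′ ∈ I → j′ ∈ I → LexLt j i j′ i′ → Stable i′ j′ L

    i≢j : i ≢ j
    i≢j = Fin.<⇒≢ i<j

  view : ∀ {L L′} → Step I L L′ → StepView L L′
  view (i , j , i<j , i∈I , j∈I , unstable , L′≡N , lastPair) =
    record { i = i ; j = j ; i<j = i<j ; i∈I = i∈I ; j∈I = j∈I ; unstable = unstable ; L′≡N = L′≡N ; lastPair = lastPair }

  isSubspace-after : ∀ {L L′} → StepView L L′ → IsSubspace L′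
  isSubspace-after step = IsSubspace-resp-≡ₛ (≡ₛ-sym (StepView.L′≡N step)) (Span-isSubspace _)

  module AfterStep {L L′ : Sub} (L-sub : IsSubspace L) (L-fg : DoubleNegation (FinitelyGenerated L))
                   (step : StepView L L′) where
    open StepView step public
    open Shift i j i≢j L-sub

    finitelyGenerated-after : DoubleNegation (FinitelyGenerated L′)
    finitelyGenerated-after = L-fg >>= λ fg → shiftFacts fg >>= λ facts →
      return (FinitelyGenerated-resp-≡ₛ (≡ₛ-sym L′≡N) (ShiftFacts.N-finitelyGenerated facts))

    partX-closed-after : DoubleNegation (PartXClosed j L′)
    partX-closed-after = L-fg >>= λ fg → shiftFacts fg >>= λ facts →
      return {A = PartXClosed j L′} (PartXClosed-resp-≡ₛ (≡ₛ-sym L′≡N) (AfterShift.N-partX-closed facts))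

    partX-closed⇒stable-after : DoubleNegation (PartXClosed j L) → DoubleNegation (Stable i j L′)
    partX-closed⇒stable-after X-closed = X-closed >>= λ X-closed → L-fg >>= λ fg → shiftFacts fg >>= λ facts →
      let open AfterShift facts in
      Shift.closed⇒stable i j i≢j N-isSubspace N-partX-closed (partX-closed⇒N-transfer-closed X-closed)
                          (ShiftFacts.N-finitelyGenerated facts) >>= λ stable →
      return (Stable-resp-≡ₛ i j (≡ₛ-sym L′≡N) stable)

    module LaterPair {i′ j′} (i′<j′ : i′ Fin.< j′) (i′∈I : i′ ∈ I) (j′∈I : j′ ∈ I) (later : LexLt j i j′ i′)
                     (facts : ShiftFacts) where
      open AfterShift facts

      i′≢j′ : i′ ≢ j′
      i′≢j′ = Fin.<⇒≢ i′<j′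

      stable-before : Stable i′ j′ L
      stable-before = lastPair i′ j′ i′<j′ i′∈I j′∈I later

      T-closed-before : TransferClosed j′ i′ L
      T-closed-before = Shift.stable⇒transfer-closed i′ j′ i′≢j′ L-sub stable-before

      j<j′ : j′ ≢ j → j Fin.< j′
      j<j′ j′≢j = [ id , (λ (j≡j′ , _) → ⊥-elim (j′≢j (sym j≡j′))) ] later

      j′≢i : j′ ≢ j → j′ ≢ i
      j′≢i j′≢j = Fin.<⇒≢ (Fin.<-trans i<j (j<j′ j′≢j)) ∘ sym

      N-partX-closed′ : PartXClosed j′ N
      N-partX-closed′ with j′ Fin.≟ j
      ... | yes refl = N-partX-closed
      ... | no j′≢j  = partX-closed-preserved (j′≢i j′≢j) j′≢j (Shift.stable⇒partX-closed i′ j′ i′≢j′ L-sub stable-before)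

      N-transfer-closed′ : TransferClosed j′ i′ N
      N-transfer-closed′ with j′ Fin.≟ j
      ... | yes refl = transfer-closed-preserved-sameSource i′≢j′ T-closed-before
      ... | no j′≢j with i′ Fin.≟ i | i′ Fin.≟ j
      ...   | yes refl | _        = transfer-closed-preserved-sameTarget (j′≢j ∘ sym) (j′≢i j′≢j) T-closed-before
      ...   | no _     | yes refl = transfer-closed-preserved-intoSource j′≢j (j′≢i j′≢j) T-closed-before
                                      (Shift.stable⇒transfer-closed i j′ i≢j′ L-sub
                                        (lastPair i j′ i<j′ i∈I j′∈I (inj₁ (j<j′ j′≢j))))
        where
        i<j′ = Fin.<-trans i<j (j<j′ j′≢j)
        i≢j′ = Fin.<⇒≢ i<j′
      ...   | no i′≢i  | no i′≢j  = transfer-closed-preserved (i′≢j ∘ sym) (j′≢j ∘ sym) (i′≢i ∘ sym) (j′≢i j′≢j ∘ sym)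
                                      T-closed-before

    later-pairs-stable-after : ∀ {i′ j′} → i′ Fin.< j′ → i′ ∈ I → j′ ∈ I → LexLt j i j′ i′ →
                               DoubleNegation (Stable i′ j′ L′)
    later-pairs-stable-after {i′} {j′} i′<j′ i′∈I j′∈I later = L-fg >>= λ fg → shiftFacts fg >>= λ facts →
      let open LaterPair i′<j′ i′∈I j′∈I later facts in
      Shift.closed⇒stable i′ j′ i′≢j′ N-isSubspace N-partX-closed′ N-transfer-closed′
                          (ShiftFacts.N-finitelyGenerated facts) >>= λ stable →
      return (Stable-resp-≡ₛ i′ j′ (≡ₛ-sym L′≡N) stable)

  module Run (gens : List Form) (m : ℕ) (Ls : ℕ → Sub) (L₀≡⟨gens⟩ : Ls 0 ≡ₛ SpanList gens)
             (steps : ∀ s → s < m → Step I (Ls s) (Ls (suc s))) where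
    open Rank I

    step : ∀ s → s < m → StepView (Ls s) (Ls (suc s))
    step s h = view (steps s h)

    isSubspace-at : ∀ s → s ≤ m → IsSubspace (Ls s)
    isSubspace-at zero    _   = IsSubspace-resp-≡ₛ (≡ₛ-sym L₀≡⟨gens⟩) (SpanList-isSubspace gens)
    isSubspace-at (suc s) s<m = isSubspace-after (step s s<m)

    finitelyGenerated-at : ∀ s → s ≤ m → DoubleNegation (FinitelyGenerated (Ls s))
    finitelyGenerated-at zero    _   =
      return (gens , All.map (proj₂ (L₀≡⟨gens⟩ _)) (SpanList-generators gens) , λ {v} → proj₁ (L₀≡⟨gens⟩ v))
    finitelyGenerated-at (suc s) s<m =
      AfterStep.finitelyGenerated-after (isSubspace-at s (<⇒≤ s<m)) (finitelyGenerated-at s (<⇒≤ s<m)) (step s s<m)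

    module At (s : ℕ) (h : s < m) =
      AfterStep (isSubspace-at s (<⇒≤ h)) (finitelyGenerated-at s (<⇒≤ h)) (step s h)

    pair : ∀ s → s < m → ℕ × ℕ
    pair s h = rank (At.j s h) , rank (At.i s h)

    ordered : ∀ s h → proj₂ (pair s h) < proj₁ (pair s h)
    ordered s h = rank-strict (At.i∈I s h) (At.i<j s h)

    bounded : ∀ s h → proj₁ (pair s h) < ∣ I ∣
    bounded s h = rank<∣I∣ (At.j∈I s h)

    same-pair : ∀ {s s′ h h′} → pair s′ h′ ≡ pair s h → At.i s′ h′ ≡ At.i s h × At.j s′ h′ ≡ At.j s h
    same-pair {s} {s′} {h} {h′} e =
      rank-injective (At.i∈I s′ h′) (At.i∈I s h) (cong proj₂ e) ,
      rank-injective (At.j∈I s′ h′) (At.j∈I s h) (cong proj₁ e)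

    unstable-again : ∀ s h h′ → pair (suc s) h′ ≡ pair s h → ¬ Stable (At.i s h) (At.j s h) (Ls (suc s))
    unstable-again s h h′ e with same-pair e
    ... | i≡ , j≡ = subst₂ (λ i j → ¬ Stable i j (Ls (suc s))) i≡ j≡ (At.unstable (suc s) h′)

    no-increase : ∀ s h h′ → ¬ (pair s h <ₗₑₓ pair (suc s) h′)
    no-increase s h h′ pair< =
      At.later-pairs-stable-after s h (At.i<j (suc s) h′) (At.i∈I (suc s) h′) (At.j∈I (suc s) h′) (lexLt pair<)
        (At.unstable (suc s) h′)
      where
      lexLt : pair s h <ₗₑₓ pair (suc s) h′ → LexLt (At.j s h) (At.i s h) (At.j (suc s) h′) (At.i (suc s) h′)
      lexLt (inj₁ rj<rj′)            = inj₁ (rank-reflects-< rj<rj′)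
      lexLt (inj₂ (rj≡rj′ , ri<ri′)) =
        inj₂ (rank-injective (At.j∈I s h) (At.j∈I (suc s) h′) rj≡rj′ , rank-reflects-< ri<ri′)

    repeat⇒adjacent : ∀ s h h′ → pair (suc s) h′ ≡ pair s h → Adjacent (pair s h)
    repeat⇒adjacent s h h′ e = ≤-antisym (ordered s h) (rank-gap (At.i∈I s h) gap)
      where
      gap : ∀ {x} → x ∈ I → At.i s h Fin.< x → x Fin.< At.j s h → ⊥
      gap {x} x∈I i<x x<j =
        At.partX-closed⇒stable-after s h
          (return {A = PartXClosed (At.j s h) (Ls s)}
            (Shift.stable⇒partX-closed x (At.j s h) (Fin.<⇒≢ x<j) (isSubspace-at s (<⇒≤ h))
              (At.lastPair s h x (At.j s h) x<j x∈I (At.j∈I s h) (inj₂ (refl , i<x)))))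
          (unstable-again s h h′ e)

    no-triple : ∀ s h h′ h″ → pair (suc s) h′ ≡ pair s h → pair (suc (suc s)) h″ ≡ pair (suc s) h′ → ⊥
    no-triple s h h′ h″ e e′ =
      At.partX-closed⇒stable-after (suc s) h′
        (subst (λ j → DoubleNegation (PartXClosed j (Ls (suc s)))) (sym (proj₂ (same-pair e))) (At.partX-closed-after s h))
        (unstable-again (suc s) h′ h″ e′)

proposition3p10 : ∀ {c ℓ} (F : Field c ℓ) → CharNot2 F →
    (n k : ℕ) (gens : List (Exterior.Form F n)) →
    All (Exterior.Homogeneous F n k) gens →
    (I : Subset n) (m : ℕ) (Ls : ℕ → Exterior.Sub F n) →
    Exterior._≡ₛ_ F n (Ls 0) (Exterior.SpanList F n gens) →
    (∀ s → s < m → Exterior.Step F n I (Ls s) (Ls (suc s))) →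
    m ≤ (∣ I ∣ ∸ 1) + (∣ I ∣ C 2)
proposition3p10 F _ n _ gens _ I m Ls L₀≡⟨gens⟩ steps =
  PairRun.length-bound ∣ I ∣ m pair ordered bounded no-increase repeat⇒adjacent no-triple
  where open Procedure.Run F n I gens m Ls L₀≡⟨gens⟩ steps
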